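{- For every $n\ge 3$, let $G_n^4$ be the graph on vertex set $\{1,2,\dots,2n+1,x,y\}$ with the following edges: the path edges $\{i,i+1\}$ for $2\le i\le 2n-1$; the edges $\{1,i\}$ and $\{2n+1,i\}$ for all $2\le i\le 2n$; the edge $\{1,2n+1\}$; and the edges $\{1,x\}$, $\{2n,x\}$, $\{2,y\}$, $\{2n+1,y\}$. There are no other edges. Then $G_n^4$ is a minimal non-word-representable graph, i.e. $G_n^4$ is not word-representable but every proper induced subgraph of it is word-representable.
   Context: All graphs are finite and simple. For a word $w$ and letters $i,j$, let $w_{ij}$ be the subsequence of $w$ consisting of all occurrences of $i$ and $j$; $i$ and $j$ alternate in $w$ if $w_{ij}$ contains no factor $ii$ or $jj$. A graph $G$ is word-representable if there is a word $w$ over $V(G)$ such that for all distinct $i,j\in V(G)$, $\{i,j\}\in E(G)$ if and only if $i$ and $j$ alternate in $w$. -}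

module Defs where

open import Data.Nat using (ℕ; zero; suc; _+_; _*_; _∸_; _≤_; _≤?_; _≟_)
open import Data.Fin using (Fin; toℕ)
open import Data.Fin.Properties as FinP using ()
open import Data.Bool using (Bool; true; false; T; _∨_; if_then_else_)
open import Data.List using (List; []; _∷_; _++_; filter)
open import Data.Product using (Σ; ∃; ∃-syntax; _×_; _,_; proj₁; proj₂)
open import Data.Sum using (_⊎_)
open import Data.Unit using (tt)
open import Relation.Nullary using (¬_; Dec; yes; no; does; _⊎-dec_)
open import Relation.Binary.PropositionalEquality using (_≡_; refl; _≢_; cong)
open import Relation.Binary.Definitions using (DecidableEquality)
open import Function.Bundles using (_⇔_)

-- A graph: vertex type with decidable equality and an edge relation.
-- (Only edges between distinct vertices are ever consulted.)
record Graph : Set₁ where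
  field
    V    : Set
    _≟V_ : DecidableEquality V
    E    : V → V → Set
open Graph public

HasFactor : {A : Set} → A → A → List A → Set
HasFactor a b l = ∃[ us ] ∃[ vs ] (l ≡ us ++ a ∷ b ∷ vs)

module _ {A : Set} (_≟A_ : DecidableEquality A) where
  restrict : A → A → List A → List A
  restrict i j w = filter (λ c → (c ≟A i) ⊎-dec (c ≟A j)) w

  Alternate : A → A → List A → Set
  Alternate i j w = ¬ HasFactor i i (restrict i j w) × ¬ HasFactor j j (restrict i j w)

WordRepresentable : Graph → Set
WordRepresentable G =
  ∃[ w ] (∀ (i j : V G) → i ≢ j → (E G i j ⇔ Alternate (_≟V_ G) i j w))

Induced : (G : Graph) → (V G → Bool) → Graph
Induced G S = record
  { V = Σ (V G) (λ v → T (S v))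
  ; _≟V_ = deq
  ; E = λ a b → E G (proj₁ a) (proj₁ b)
  }
  where
  T-irr : ∀ {b} (p q : T b) → p ≡ q
  T-irr {true} tt tt = refl
  deq : DecidableEquality (Σ (V G) (λ v → T (S v)))
  deq (a , p) (b , q) with _≟V_ G a b
  ... | no a≢b = no λ { refl → a≢b refl }
  ... | yes refl with T-irr p q
  ... | refl = yes refl

MinimalNonWordRepresentable : Graph → Set
MinimalNonWordRepresentable G =
  ¬ WordRepresentable G ×
  (∀ (S : V G → Bool) → (∃[ v ] S v ≡ false) → WordRepresentable (Induced G S))

data Label : Set where
  num : ℕ → Label
  lx  : Label
  ly  : Label

-- vertices are Fin (2n+3): index k ≤ 2n is vertex k+1, index 2n+1 is x, 2n+2 is y
label : (n : ℕ) → Fin (2 * n + 3) → Label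
label n k with toℕ k ≤? 2 * n
... | yes _ = num (suc (toℕ k))
... | no _ with toℕ k ≟ suc (2 * n)
...   | yes _ = lx
...   | no _  = ly

data BaseEdge (n : ℕ) : Label → Label → Set where
  path    : ∀ i → 2 ≤ i → i ≤ 2 * n ∸ 1 → BaseEdge n (num i) (num (suc i))
  one     : ∀ i → 2 ≤ i → i ≤ 2 * n → BaseEdge n (num 1) (num i)
  top     : ∀ i → 2 ≤ i → i ≤ 2 * n → BaseEdge n (num (2 * n + 1)) (num i)
  one-top : BaseEdge n (num 1) (num (2 * n + 1))
  one-x   : BaseEdge n (num 1) lx
  twon-x  : BaseEdge n (num (2 * n)) lx
  two-y   : BaseEdge n (num 2) ly
  top-y   : BaseEdge n (num (2 * n + 1)) ly

G4 : ℕ → Graph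
G4 n = record
  { V = Fin (2 * n + 3)
  ; _≟V_ = FinP._≟_
  ; E = λ a b → BaseEdge n (label n a) (label n b) ⊎ BaseEdge n (label n b) (label n a)
  }

-- If a word w represents G, order the letters cyclically by their first
-- occurrence in w followed by all letters.  If c p q and c q r are triangles of pairwise
-- alternating letters oriented the same way, then p and r alternate as well; hence in a
-- diamond c p q r of G (missing edge pr) the triangles c p q and c q r are oriented
-- oppositely.  Starting from the orientation of 1, 2n, 2n + 1 (up to reversal), diamonds
-- through x and along the path 2n, 2n − 1, …, 2 fix the orientation of 1, 2, 3, those
-- through 2n + 1 fix the orientations of 1, 2, 2n + 1 and 1, 3, 2n + 1, and these clash
-- at the diamond with hub 2n + 1 on y, 2, 3.
--
-- Conversely each vertex-deleted subgraph is a permutation graph: there are two keys per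
-- vertex such that exactly the adjacent pairs are ordered differently by them, and the
-- letters listed by the first key followed by the letters listed backwards by the second
-- key form a representing word.  The inner path zigzags between the keys; its phase is
-- pinned at vertex 2 by y and at vertex 2n by x, and the two pins are compatible only
-- after deleting a vertex, which removes a pin or cuts the path.

module Submission where

open import Defs
open import Data.Bool using (Bool; true; false; T)
open import Data.Bool.Properties using (T-irrelevant)
open import Data.Empty using (⊥; ⊥-elim)
open import Data.Fin as Fin using (Fin; toℕ; fromℕ<)
import Data.Fin.Properties as Fin
open import Data.Fin.Properties using (toℕ-fromℕ<; toℕ-injective; toℕ<n)
open import Data.List using (List; []; _∷_; _++_; _∷ʳ_; filter; length; reverse; allFin)
open import Data.List.Properties
  using (∷-injective; ∷-injectiveʳ; ++-assoc; ++-identityʳ; unfold-reverse;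
         filter-accept; filter-reject; filter-none; filter-++; filter-≐)
open import Data.List.Membership.Propositional using (_∈_; _∉_)
open import Data.List.Membership.Propositional.Properties
  using (∈-++⁻; ∈-++⁺ˡ; ∈-++⁺ʳ; ∈-filter⁻; ∈-allFin)
open import Data.List.Relation.Unary.All as All using (All; []; _∷_)
open import Data.List.Relation.Unary.AllPairs using ([]; _∷_)
open import Data.List.Relation.Unary.Any using (here; there)
open import Data.List.Relation.Unary.First using (FirstView; first) renaming (_++_∷_ to _⟨_⟩_)
open import Data.List.Relation.Unary.First.Properties using (toView)
open import Data.List.Relation.Unary.Unique.Propositional using (Unique)
open import Data.List.Relation.Unary.Unique.Propositional.Properties using (allFin⁺)
open import Data.List.Reverse using (Reverse; []; _∶_∶ʳ_; reverseView)
open import Data.Nat using (ℕ; zero; suc; _+_; _*_; _∸_; _≤_; _<_; _≤?_; _<?_; z≤n; s≤s)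
import Data.Nat as ℕ
open import Data.Nat.Properties
open import Data.Product using (Σ; ∃-syntax; _×_; _,_; proj₁; proj₂)
import Data.Product as Product
open import Data.Sum using (_⊎_; inj₁; inj₂; [_,_]′)
import Data.Sum as Sum
open import Data.Unit using (⊤; tt)
open import Function using (_∘_)
open import Function.Bundles using (_⇔_; mk⇔; Equivalence)
import Function.Properties.Equivalence as ⇔
open import Relation.Binary.Definitions using (DecidableEquality; tri<; tri≈; tri>)
open import Relation.Binary.PropositionalEquality
  using (_≡_; refl; _≢_; sym; trans; cong; cong₂; subst; subst₂; module ≡-Reasoning)
open import Relation.Nullary using (¬_; Dec; yes; no; does; _⊎-dec_; contradiction)
open import Relation.Nullary.Decidable using (True; toWitness; toSum; T?; dec-true; dec-false)
open import Relation.Unary using (Decidable)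

-- Cyclic orders on ℕ

Cyclic : ℕ → ℕ → ℕ → Set
Cyclic x y z = (x < y × y < z) ⊎ (y < z × z < x) ⊎ (z < x × x < y)

module _ where

  private variable
    a b c x y z : ℕ

  cyclic-rotate : Cyclic x y z → Cyclic y z x
  cyclic-rotate (inj₁ h)        = inj₂ (inj₂ h)
  cyclic-rotate (inj₂ (inj₁ h)) = inj₁ h
  cyclic-rotate (inj₂ (inj₂ h)) = inj₂ (inj₁ h)

  cyclic-irrefl : ¬ Cyclic x x y
  cyclic-irrefl (inj₁ (x<x , _))        = <-irrefl refl x<x
  cyclic-irrefl (inj₂ (inj₁ (x<y , y<x))) = <-asym x<y y<x
  cyclic-irrefl (inj₂ (inj₂ (_ , x<x))) = <-irrefl refl x<x

  cyclic-asym : Cyclic x y z → ¬ Cyclic x z y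
  cyclic-asym (inj₁ (_ , y<z))          (inj₁ (_ , z<y))          = <-asym y<z z<y
  cyclic-asym (inj₁ (_ , y<z))          (inj₂ (inj₁ (z<y , _)))   = <-asym y<z z<y
  cyclic-asym (inj₁ (x<y , _))          (inj₂ (inj₂ (y<x , _)))   = <-asym x<y y<x
  cyclic-asym (inj₂ (inj₁ (y<z , _)))   (inj₁ (_ , z<y))          = <-asym y<z z<y
  cyclic-asym (inj₂ (inj₁ (y<z , _)))   (inj₂ (inj₁ (z<y , _)))   = <-asym y<z z<y
  cyclic-asym (inj₂ (inj₁ (_ , z<x)))   (inj₂ (inj₂ (_ , x<z)))   = <-asym z<x x<z
  cyclic-asym (inj₂ (inj₂ (z<x , _)))   (inj₁ (x<z , _))          = <-asym z<x x<z
  cyclic-asym (inj₂ (inj₂ (_ , x<y)))   (inj₂ (inj₁ (_ , y<x)))   = <-asym x<y y<x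
  cyclic-asym (inj₂ (inj₂ (_ , x<y)))   (inj₂ (inj₂ (y<x , _)))   = <-asym x<y y<x

  cyclic-total : x ≢ y → y ≢ z → x ≢ z → Cyclic x y z ⊎ Cyclic x z y
  cyclic-total {x} {y} {z} x≢y y≢z x≢z with <-cmp x y | <-cmp y z | <-cmp x z
  ... | tri≈ _ x≡y _ | _            | _            = ⊥-elim (x≢y x≡y)
  ... | _            | tri≈ _ y≡z _ | _            = ⊥-elim (y≢z y≡z)
  ... | _            | _            | tri≈ _ x≡z _ = ⊥-elim (x≢z x≡z)
  ... | tri< x<y _ _ | tri< y<z _ _ | _            = inj₁ (inj₁ (x<y , y<z))
  ... | tri< x<y _ _ | tri> _ _ z<y | tri< x<z _ _ = inj₂ (inj₁ (x<z , z<y))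
  ... | tri< x<y _ _ | tri> _ _ z<y | tri> _ _ z<x = inj₁ (inj₂ (inj₂ (z<x , x<y)))
  ... | tri> _ _ y<x | tri< y<z _ _ | tri< x<z _ _ = inj₂ (inj₂ (inj₂ (y<x , x<z)))
  ... | tri> _ _ y<x | tri< y<z _ _ | tri> _ _ z<x = inj₁ (inj₂ (inj₁ (y<z , z<x)))
  ... | tri> _ _ y<x | tri> _ _ z<y | _            = inj₂ (inj₂ (inj₁ (z<y , y<x)))

  cyclic-trans : Cyclic a x y → Cyclic a y z → Cyclic x y z
  cyclic-trans (inj₁ (_ , x<y))          (inj₁ (_ , y<z))          = inj₁ (x<y , y<z)
  cyclic-trans (inj₁ (a<x , x<y))        (inj₂ (inj₁ (y<z , z<a))) =
    ⊥-elim (<-asym (<-trans a<x x<y) (<-trans y<z z<a))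
  cyclic-trans (inj₁ (a<x , x<y))        (inj₂ (inj₂ (z<a , _)))   = inj₂ (inj₂ (<-trans z<a a<x , x<y))
  cyclic-trans (inj₂ (inj₁ (_ , y<a)))   (inj₁ (a<y , _))          = ⊥-elim (<-asym y<a a<y)
  cyclic-trans (inj₂ (inj₁ (x<y , _)))   (inj₂ (inj₁ (y<z , _)))   = inj₁ (x<y , y<z)
  cyclic-trans (inj₂ (inj₁ (_ , y<a)))   (inj₂ (inj₂ (_ , a<y)))   = ⊥-elim (<-asym y<a a<y)
  cyclic-trans (inj₂ (inj₂ (y<a , _)))   (inj₁ (a<y , _))          = ⊥-elim (<-asym y<a a<y)
  cyclic-trans (inj₂ (inj₂ (_ , a<x)))   (inj₂ (inj₁ (y<z , z<a))) = inj₂ (inj₁ (y<z , <-trans z<a a<x))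
  cyclic-trans (inj₂ (inj₂ (y<a , _)))   (inj₂ (inj₂ (_ , a<y)))   = ⊥-elim (<-asym y<a a<y)

-- Words

module Words {A : Set} (_≟_ : DecidableEquality A) where

  open import Data.List.Membership.DecPropositional _≟_ using (_∈?_)

  private variable
    a b c i j s t u z : A
    S xs ys zs w : List A

  Absent : List A → List A → Set
  Absent S xs = All (_∉ xs) S

  absent : All (_∉ S) xs → Absent S xs
  absent outside = All.tabulate (λ s∈S s∈xs → All.lookup outside s∈xs s∈S)

  absent-[] : Absent S []
  absent-[] = All.tabulate λ _ ()

  absent-∷ : z ∉ S → Absent S ys → Absent S (z ∷ ys)
  absent-∷ z∉S h = All.tabulate λ where
    s∈S (here refl)    → z∉S s∈S
    s∈S (there s∈ys) → All.lookup h s∈S s∈ys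

  ∈-pair⁺ : z ≡ i ⊎ z ≡ j → z ∈ i ∷ j ∷ []
  ∈-pair⁺ (inj₁ e) = here e
  ∈-pair⁺ (inj₂ e) = there (here e)

  ∈-pair⁻ : z ∈ i ∷ j ∷ [] → z ≡ i ⊎ z ≡ j
  ∈-pair⁻ (here e) = inj₁ e
  ∈-pair⁻ (there (here e)) = inj₂ e

  restrict-sym : ∀ i j w → restrict _≟_ i j w ≡ restrict _≟_ j i w
  restrict-sym i j =
    filter-≐ (λ c → (c ≟ i) ⊎-dec (c ≟ j)) (λ c → (c ≟ j) ⊎-dec (c ≟ i)) (Sum.swap , Sum.swap)

  alternate-sym : ∀ w → Alternate _≟_ i j w → Alternate _≟_ j i w
  alternate-sym {i = i} {j = j} w (no-ii , no-jj) rewrite restrict-sym i j w = no-jj , no-ii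

  module _ (i j : A) where

    private
      R : List A → List A
      R = restrict _≟_ i j

      kept? : ∀ c → Dec (c ≡ i ⊎ c ≡ j)
      kept? c = (c ≟ i) ⊎-dec (c ≟ j)

    restrict-++ : ∀ xs ys → R (xs ++ ys) ≡ R xs ++ R ys
    restrict-++ = filter-++ kept?

    restrict-kept : ∀ w → z ∈ i ∷ j ∷ [] → R (z ∷ w) ≡ z ∷ R w
    restrict-kept w z∈ = filter-accept kept? (∈-pair⁻ z∈)

    restrict-dropped : ∀ w → z ∉ i ∷ j ∷ [] → R (z ∷ w) ≡ R w
    restrict-dropped w z∉ = filter-reject kept? (z∉ ∘ ∈-pair⁺)

    restrict-absent : Absent (i ∷ j ∷ []) ys → R ys ≡ []
    restrict-absent (i∉ ∷ j∉ ∷ []) = filter-none kept? (All.tabulate λ z∈ys →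
      [ (λ { refl → i∉ z∈ys }) , (λ { refl → j∉ z∈ys }) ]′)

    repeat-breaks-alternation : w ≡ xs ++ i ∷ ys ++ i ∷ zs → Absent (i ∷ j ∷ []) ys →
                                ¬ Alternate _≟_ i j w
    repeat-breaks-alternation {xs = xs} {ys} {zs} refl ij∉ys (no-ii , _) = no-ii (R xs , R zs , restrict-repeat)
      where
      open ≡-Reasoning
      restrict-repeat : R (xs ++ i ∷ ys ++ i ∷ zs) ≡ R xs ++ i ∷ i ∷ R zs
      restrict-repeat = begin
        R (xs ++ i ∷ ys ++ i ∷ zs)       ≡⟨ restrict-++ xs _ ⟩
        R xs ++ R (i ∷ ys ++ i ∷ zs)     ≡⟨ cong (R xs ++_) (restrict-kept _ (here refl)) ⟩
        R xs ++ i ∷ R (ys ++ i ∷ zs)     ≡⟨ cong (λ v → R xs ++ i ∷ v) (restrict-++ ys _) ⟩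
        R xs ++ i ∷ R ys ++ R (i ∷ zs)   ≡⟨ cong (λ v → R xs ++ i ∷ v ++ R (i ∷ zs))
                                                 (restrict-absent ij∉ys) ⟩
        R xs ++ i ∷ R (i ∷ zs)           ≡⟨ cong (λ v → R xs ++ i ∷ v) (restrict-kept zs (here refl)) ⟩
        R xs ++ i ∷ i ∷ R zs             ∎

    restriction-head : R w ≡ z ∷ xs → ∃[ ys ] ∃[ zs ] (Absent (i ∷ j ∷ []) ys × w ≡ ys ++ z ∷ zs)
    restriction-head {w = []} ()
    restriction-head {w = u ∷ w} eq with u ∈? (i ∷ j ∷ [])
    ... | yes u∈ with trans (sym (restrict-kept w u∈)) eq
    ...   | refl = [] , w , absent-[] , refl
    restriction-head {w = u ∷ w} eq | no u∉
      with restriction-head {w = w} (trans (sym (restrict-dropped w u∉)) eq)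
    ... | ys , zs , av , refl = u ∷ ys , zs , absent-∷ u∉ av , refl

    repeat-in-restriction : HasFactor z z (R w) →
                            ∃[ xs ] ∃[ ys ] ∃[ zs ]
                              (Absent (i ∷ j ∷ []) ys × w ≡ xs ++ z ∷ ys ++ z ∷ zs)
    repeat-in-restriction {w = []} ([] , _ , ())
    repeat-in-restriction {w = []} (_ ∷ _ , _ , ())
    repeat-in-restriction {w = u ∷ w} (us , vs , eq) with u ∈? (i ∷ j ∷ [])
    ... | no u∉ with repeat-in-restriction {w = w} (us , vs , trans (sym (restrict-dropped w u∉)) eq)
    ...   | xs , ys , zs , av , refl = u ∷ xs , ys , zs , av , refl
    repeat-in-restriction {w = u ∷ w} ([] , vs , eq) | yes u∈
      with ∷-injective (trans (sym (restrict-kept w u∈)) eq)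
    ... | refl , eq′ with restriction-head {w = w} eq′
    ...   | ys , zs , av , refl = [] , ys , zs , av , refl
    repeat-in-restriction {w = u ∷ w} (_ ∷ us , vs , eq) | yes u∈
      with repeat-in-restriction {w = w} (us , vs , ∷-injectiveʳ (trans (sym (restrict-kept w u∈)) eq))
    ... | xs , ys , zs , av , refl = u ∷ xs , ys , zs , av , refl

  first-of : ∀ S xs → Absent S xs ⊎ FirstView (_∉ S) (_∈ S) xs
  first-of S xs = Sum.swap (Sum.map toView absent (first (λ z → Sum.swap (toSum (z ∈? S))) xs))

  ∉-++-∷ : s ∉ xs → s ≢ z → s ∉ ys → s ∉ xs ++ z ∷ ys
  ∉-++-∷ {xs = xs} s∉xs s≢z s∉ys s∈ with ∈-++⁻ xs s∈
  ... | inj₁ s∈xs = s∉xs s∈xs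
  ... | inj₂ (here s≡z) = s≢z s≡z
  ... | inj₂ (there s∈ys) = s∉ys s∈ys

  position : A → List A → ℕ
  position a [] = 0
  position a (b ∷ w) with a ≟ b
  ... | yes _ = 0
  ... | no _  = suc (position a w)

  position-++ : ∀ xs → s ∉ xs → position s (xs ++ ys) ≡ length xs + position s ys
  position-++ [] s∉ = refl
  position-++ {s = s} (x ∷ xs) s∉ with s ≟ x
  ... | yes s≡x = ⊥-elim (s∉ (here s≡x))
  ... | no _    = cong suc (position-++ xs (s∉ ∘ there))

  position-injective : ∀ {s t} w → s ∈ w → position s w ≡ position t w → s ≡ t
  position-injective {s} {t} (x ∷ w) s∈ eq with s ≟ x | t ≟ x
  ... | yes s≡x | yes t≡x = trans s≡x (sym t≡x)
  ... | yes _   | no _    with eq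
  ...   | ()
  position-injective (x ∷ w) s∈ eq | no _ | yes _ with eq
  ... | ()
  position-injective (x ∷ w) (here s≡x) eq | no s≢x | no _ = ⊥-elim (s≢x s≡x)
  position-injective (x ∷ w) (there s∈) eq | no _ | no _ = position-injective w s∈ (suc-injective eq)

  position-head : position s (s ∷ ys) ≡ 0
  position-head {s = s} with s ≟ s
  ... | yes _   = refl
  ... | no s≢s = ⊥-elim (s≢s refl)

  position-skip : t ≢ s → position t (s ∷ ys) ≡ suc (position t ys)
  position-skip {t = t} {s = s} t≢s with t ≟ s
  ... | yes t≡s = ⊥-elim (t≢s t≡s)
  ... | no _    = refl

  first-occurrence-< : ∀ xs → s ∉ xs → t ∉ xs → t ≢ s →
                       position s (xs ++ s ∷ ys) < position t (xs ++ s ∷ ys)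
  first-occurrence-< {s = s} {t = t} {ys = ys} xs s∉ t∉ t≢s = begin-strict
    position s (xs ++ s ∷ ys)          ≡⟨ position-++ xs s∉ ⟩
    length xs + position s (s ∷ ys)    ≡⟨ cong (length xs +_) position-head ⟩
    length xs + 0                      <⟨ +-monoʳ-< (length xs) (s≤s z≤n) ⟩
    length xs + suc (position t ys)    ≡⟨ cong (length xs +_) (sym (position-skip t≢s)) ⟩
    length xs + position t (s ∷ ys)    ≡⟨ sym (position-++ xs t∉) ⟩
    position t (xs ++ s ∷ ys)          ∎
    where open ≤-Reasoning

  module FirstOccurrences (w tail : List A) where

    pos : A → ℕ
    pos s = position s (w ++ tail)

    record Triangle (a b c : A) : Set where
      field
        ab : Alternate _≟_ a b w
        bc : Alternate _≟_ b c w
        ca : Alternate _≟_ c a w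
        cyclic : Cyclic (pos a) (pos b) (pos c)

    rotate : Triangle a b c → Triangle b c a
    rotate t = record { ab = bc ; bc = ca ; ca = ab ; cyclic = cyclic-rotate cyclic }
      where open Triangle t

    distinct : Triangle a b c → a ≢ b
    distinct t refl = cyclic-irrefl (Triangle.cyclic t)

    -- Look at the last letter of the triangle before b: by alternation it is neither a nor b,
    -- and if it is c then c is followed by b, which the rotated triangle forbids.  If there is
    -- none, b, a and c occur first in this order, against the orientation of the triangle.
    never-followed-by-predecessor′ : Triangle a b c → ∀ {pre gap mid post} → Reverse pre →
                                     Absent (a ∷ b ∷ c ∷ []) gap → Absent (a ∷ b ∷ c ∷ []) mid →
                                     w ≢ pre ++ gap ++ b ∷ mid ++ a ∷ post
    never-followed-by-predecessor′ {a} {b} {c} t {gap = gap} {mid} {post} []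
                                   (a∉gap ∷ b∉gap ∷ c∉gap ∷ []) (a∉mid ∷ _ ∷ c∉mid ∷ []) eq =
      cyclic-asym cyclic (cyclic-rotate (inj₁ (b<a , a<c)))
      where
      open Triangle t
      open ≡-Reasoning
      w-at-b : w ++ tail ≡ gap ++ b ∷ (mid ++ a ∷ post ++ tail)
      w-at-b = begin
        w ++ tail                              ≡⟨ cong (_++ tail) eq ⟩
        (gap ++ b ∷ mid ++ a ∷ post) ++ tail   ≡⟨ ++-assoc gap _ tail ⟩
        gap ++ b ∷ (mid ++ a ∷ post) ++ tail   ≡⟨ cong (λ v → gap ++ b ∷ v) (++-assoc mid _ tail) ⟩
        gap ++ b ∷ mid ++ a ∷ post ++ tail     ∎
      w-at-a : w ++ tail ≡ (gap ++ b ∷ mid) ++ a ∷ post ++ tail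
      w-at-a = trans w-at-b (sym (++-assoc gap (b ∷ mid) _))
      b<a : pos b < pos a
      b<a = subst (λ v → position b v < position a v) (sym w-at-b)
                  (first-occurrence-< gap b∉gap a∉gap (distinct t))
      a<c : pos a < pos c
      a<c = subst (λ v → position a v < position c v) (sym w-at-a)
                  (first-occurrence-< (gap ++ b ∷ mid) (∉-++-∷ a∉gap (distinct t) a∉mid)
                     (∉-++-∷ c∉gap (distinct (rotate t) ∘ sym) c∉mid) (distinct (rotate (rotate t))))
    never-followed-by-predecessor′ {a} {b} {c} t {gap = gap} {mid} {post} (pre ∶ r ∶ʳ z)
                                   gap-abs@(a∉gap ∷ b∉gap ∷ c∉gap ∷ [])
                                   mid-abs@(a∉mid ∷ _ ∷ c∉mid ∷ []) eq
      with z ∈? (a ∷ b ∷ c ∷ []) | trans eq (++-assoc pre (z ∷ []) (gap ++ b ∷ mid ++ a ∷ post))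
    ... | no z∉ | w-at-z = never-followed-by-predecessor′ t r (absent-∷ z∉ gap-abs) mid-abs w-at-z
    ... | yes (here refl) | w-at-z =
      repeat-breaks-alternation a c w-at-a
        (∉-++-∷ a∉gap (distinct t) a∉mid ∷ ∉-++-∷ c∉gap (distinct (rotate t) ∘ sym) c∉mid ∷ [])
        (alternate-sym w (Triangle.ca t))
      where
      w-at-a : w ≡ pre ++ a ∷ (gap ++ b ∷ mid) ++ a ∷ post
      w-at-a = trans w-at-z (cong (λ v → pre ++ a ∷ v) (sym (++-assoc gap (b ∷ mid) (a ∷ post))))
    ... | yes (there (here refl)) | w-at-z =
      repeat-breaks-alternation b a w-at-z (b∉gap ∷ a∉gap ∷ []) (alternate-sym w (Triangle.ab t))
    ... | yes (there (there (here refl))) | w-at-z =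
      never-followed-by-predecessor′ (rotate t) r absent-[] (b∉gap ∷ c∉gap ∷ a∉gap ∷ []) w-at-z

    never-followed-by-predecessor : Triangle a b c → ∀ {pre mid post} → Absent (a ∷ b ∷ c ∷ []) mid →
                                    w ≢ pre ++ b ∷ mid ++ a ∷ post
    never-followed-by-predecessor t {pre} = never-followed-by-predecessor′ t (reverseView pre) absent-[]

    private
      regroup₁ : ∀ xs ys zs v → xs ++ u ∷ (ys ++ s ∷ zs) ++ v ≡ xs ++ u ∷ ys ++ s ∷ zs ++ v
      regroup₁ {u = u} xs ys zs v = cong (λ l → xs ++ u ∷ l) (++-assoc ys _ v)

      regroup₂ : ∀ xs ys zs vs v →
                 xs ++ u ∷ (ys ++ s ∷ zs ++ t ∷ vs) ++ v ≡ (xs ++ u ∷ ys) ++ s ∷ zs ++ t ∷ vs ++ v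
      regroup₂ {u = u} {s = s} {t = t} xs ys zs vs v = begin
        xs ++ u ∷ (ys ++ s ∷ zs ++ t ∷ vs) ++ v   ≡⟨ regroup₁ xs ys (zs ++ t ∷ vs) v ⟩
        xs ++ u ∷ ys ++ s ∷ (zs ++ t ∷ vs) ++ v   ≡⟨ cong (λ l → xs ++ u ∷ ys ++ s ∷ l)
                                                         (++-assoc zs _ v) ⟩
        xs ++ u ∷ ys ++ s ∷ zs ++ t ∷ vs ++ v     ≡⟨ ++-assoc xs (u ∷ ys) _ ⟨
        (xs ++ u ∷ ys) ++ s ∷ zs ++ t ∷ vs ++ v   ∎
        where open ≡-Reasoning

    partner-comes-next : ∀ {pre ys zs post} →
                         Alternate _≟_ u t w → Alternate _≟_ s t w → s ≢ t →
                         w ≡ pre ++ u ∷ (ys ++ s ∷ zs) ++ u ∷ post → u ∉ ys ++ s ∷ zs → t ∉ ys →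
                         ∃[ zs₁ ] ∃[ zs₂ ] (Absent (s ∷ t ∷ []) zs₁ × zs ≡ zs₁ ++ t ∷ zs₂)
    partner-comes-next {u = u} {t = t} {s = s} {pre} {ys} {zs} {post} u-t s-t s≢t eq u∉ t∉ys
      with first-of (s ∷ t ∷ []) zs
    ... | inj₁ (_ ∷ t∉zs ∷ []) =
      ⊥-elim (repeat-breaks-alternation u t eq (u∉ ∷ ∉-++-∷ t∉ys (s≢t ∘ sym) t∉zs ∷ []) u-t)
    ... | inj₂ (_⟨_⟩_ {zs₁} outside (here refl) zs₂) =
      ⊥-elim (repeat-breaks-alternation s t (trans eq (regroup₂ pre ys zs₁ zs₂ (u ∷ post)))
                (absent outside) s-t)
    ... | inj₂ (_⟨_⟩_ {zs₁} outside (there (here refl)) zs₂) = zs₁ , zs₂ , absent outside , refl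

    -- Between two consecutive p's (or r's) both c and q occur; whichever of them comes first,
    -- some letter of one of the two triangles is directly followed by its predecessor.
    no-repeated-first : ∀ {p q r} → Triangle c p q → Triangle c q r →
                        ¬ HasFactor p p (restrict _≟_ p r w)
    no-repeated-first {c} {p} {q} {r} cpq cqr pp with repeat-in-restriction p r {w = w} pp
    ... | xs , ys , zs , p∉ys ∷ r∉ys ∷ [] , eq with first-of (c ∷ q ∷ []) ys
    ...   | inj₁ (c∉ys ∷ _ ∷ []) =
      repeat-breaks-alternation p c eq (p∉ys ∷ c∉ys ∷ []) (alternate-sym w (Triangle.ab cpq))
    ...   | inj₂ (_⟨_⟩_ {ys₁} outside (here refl) ys₂) with absent outside
    ...     | c∉ys₁ ∷ q∉ys₁ ∷ [] =
      never-followed-by-predecessor cpq (c∉ys₁ ∷ p∉ys ∘ ∈-++⁺ˡ ∷ q∉ys₁ ∷ [])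
        (trans eq (regroup₁ xs ys₁ ys₂ (p ∷ zs)))
    no-repeated-first {c} {p} {q} {r} cpq cqr pp
      | xs , ys , zs , p∉ys ∷ r∉ys ∷ [] , eq | inj₂ (_⟨_⟩_ {ys₁} outside (there (here refl)) ys₂)
      with absent outside
    ... | c∉ys₁ ∷ q∉ys₁ ∷ []
      with partner-comes-next (alternate-sym w (Triangle.ab cpq)) (Triangle.ca cpq) (distinct cqr ∘ sym)
             eq p∉ys c∉ys₁
    ... | ys₃ , ys₄ , q∉ys₃ ∷ c∉ys₃ ∷ [] , refl =
      never-followed-by-predecessor cqr
        (c∉ys₃ ∷ q∉ys₃ ∷ r∉ys ∘ ∈-++⁺ʳ ys₁ ∘ there ∘ ∈-++⁺ˡ ∷ [])
        (trans eq (regroup₂ xs ys₁ ys₃ ys₄ (p ∷ zs)))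

    no-repeated-last : ∀ {p q r} → Triangle c p q → Triangle c q r →
                       ¬ HasFactor r r (restrict _≟_ p r w)
    no-repeated-last {c} {p} {q} {r} cpq cqr rr
      with repeat-in-restriction r p {w = w} (subst (HasFactor r r) (restrict-sym p r w) rr)
    ... | xs , ys , zs , r∉ys ∷ p∉ys ∷ [] , eq with first-of (c ∷ q ∷ []) ys
    ...   | inj₁ (_ ∷ q∉ys ∷ []) =
      repeat-breaks-alternation r q eq (r∉ys ∷ q∉ys ∷ []) (alternate-sym w (Triangle.bc cqr))
    ...   | inj₂ (_⟨_⟩_ {ys₁} outside (there (here refl)) ys₂) with absent outside
    ...     | c∉ys₁ ∷ q∉ys₁ ∷ [] =
      never-followed-by-predecessor (rotate cqr) (q∉ys₁ ∷ r∉ys ∘ ∈-++⁺ˡ ∷ c∉ys₁ ∷ [])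
        (trans eq (regroup₁ xs ys₁ ys₂ (r ∷ zs)))
    no-repeated-last {c} {p} {q} {r} cpq cqr rr
      | xs , ys , zs , r∉ys ∷ p∉ys ∷ [] , eq | inj₂ (_⟨_⟩_ {ys₁} outside (here refl) ys₂)
      with absent outside
    ... | c∉ys₁ ∷ q∉ys₁ ∷ []
      with partner-comes-next (alternate-sym w (Triangle.bc cqr)) (Triangle.ab cqr) (distinct cqr) eq r∉ys q∉ys₁
    ... | ys₃ , ys₄ , c∉ys₃ ∷ q∉ys₃ ∷ [] , refl =
      never-followed-by-predecessor (rotate (rotate cpq))
        (q∉ys₃ ∷ c∉ys₃ ∷ p∉ys ∘ ∈-++⁺ʳ ys₁ ∘ there ∘ ∈-++⁺ˡ ∷ [])
        (trans eq (regroup₂ xs ys₁ ys₃ ys₄ (r ∷ zs)))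

    triangles-close : ∀ {p q r} → Triangle c p q → Triangle c q r → Alternate _≟_ p r w
    triangles-close cpq cqr = no-repeated-first cpq cqr , no-repeated-last cpq cqr

record CompatibleCyclicOrder {A : Set} (Alt : A → A → Set) : Set₁ where
  field
    Cyc        : A → A → A → Set
    total      : ∀ {a b c} → a ≢ b → b ≢ c → a ≢ c → Cyc a b c ⊎ Cyc a c b
    rotate     : ∀ {a b c} → Cyc a b c → Cyc b c a
    transitive : ∀ {a x y z} → Cyc a x y → Cyc a y z → Cyc x y z
    closes     : ∀ {c p q r} → Cyc c p q → Cyc c q r →
                 Alt c p → Alt p q → Alt q c → Alt q r → Alt r c → Alt p r

reversed : ∀ {A} {Alt : A → A → Set} → (∀ {i j} → Alt i j → Alt j i) →
           CompatibleCyclicOrder Alt → CompatibleCyclicOrder Alt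
reversed alt-sym O = record
  { Cyc        = λ a b c → Cyc a c b
  ; total      = λ a≢b b≢c a≢c → Sum.swap (total a≢b b≢c a≢c)
  ; rotate     = rotate ∘ rotate
  ; transitive = λ axy ayz → rotate (rotate (transitive ayz axy))
  ; closes     = λ cqp crq cp pq qc qr rc →
      alt-sym (closes crq cqp (alt-sym rc) (alt-sym qr) qc (alt-sym pq) (alt-sym cp))
  }
  where open CompatibleCyclicOrder O

module _ {A : Set} (_≟_ : DecidableEquality A) where
  open Words _≟_

  -- Appending every letter to w makes the first occurrences pairwise distinct.
  first-occurrence-order : ∀ w tail → (∀ a → a ∈ tail) →
                           CompatibleCyclicOrder (λ i j → Alternate _≟_ i j w)
  first-occurrence-order w tail every = record
    { Cyc        = λ a b c → Cyclic (pos a) (pos b) (pos c)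
    ; total      = λ a≢b b≢c a≢c →
        cyclic-total (a≢b ∘ pos-injective) (b≢c ∘ pos-injective) (a≢c ∘ pos-injective)
    ; rotate     = cyclic-rotate
    ; transitive = cyclic-trans
    ; closes     = λ cpq cqr cp pq qc qr rc →
        triangles-close (record { ab = cp ; bc = pq ; ca = qc ; cyclic = cpq })
                        (record { ab = alternate-sym w qc ; bc = qr ; ca = rc ; cyclic = cqr })
    }
    where
    open FirstOccurrences w tail
    pos-injective : ∀ {a b} → pos a ≡ pos b → a ≡ b
    pos-injective {a} = position-injective (w ++ tail) (∈-++⁺ʳ w (every a))

-- The graph G_n^4

twice : ℕ → ℕ
twice zero    = zero
twice (suc k) = suc (suc (twice k))

2*≡twice : ∀ k → 2 * k ≡ twice k
2*≡twice zero    = refl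
2*≡twice (suc k) = cong suc (trans (+-suc k (k + 0)) (cong suc (2*≡twice k)))

-- The vertices of G_n^4 are apex₁ = 1, apex₂ = 2n + 1, vx = x, vy = y and inner s = s + 2,
-- so that for D = 2n − 2 the path 2 … 2n is inner 0 … inner D.
data Vertex : Set where
  apex₁ apex₂ vx vy : Vertex
  inner : ℕ → Vertex

data Adj (D : ℕ) : Vertex → Vertex → Set where
  apex₁-apex₂ : Adj D apex₁ apex₂
  apex₁-inner : ∀ {s} → s ≤ D → Adj D apex₁ (inner s)
  apex₂-inner : ∀ {s} → s ≤ D → Adj D apex₂ (inner s)
  inner-inner : ∀ {s} → suc s ≤ D → Adj D (inner s) (inner (suc s))
  apex₁-vx    : Adj D apex₁ vx
  inner-vx    : Adj D (inner D) vx
  inner-vy    : Adj D (inner 0) vy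
  apex₂-vy    : Adj D apex₂ vy

Adjacent : ℕ → Vertex → Vertex → Set
Adjacent D u v = Adj D u v ⊎ Adj D v u

Valid : ℕ → Vertex → Set
Valid D (inner s) = s ≤ D
Valid D _         = ⊤

private variable
  u v : Vertex

record Diamond (D : ℕ) (c p q r : Vertex) : Set where
  constructor diamond
  field
    cp  : Adjacent D c p
    pq  : Adjacent D p q
    qc  : Adjacent D q c
    qr  : Adjacent D q r
    rc  : Adjacent D r c
    p≢r : p ≢ r
    ¬pr : ¬ Adjacent D p r

module _ {D : ℕ} where

  adj-valid : Adj D u v → Valid D u × Valid D v
  adj-valid apex₁-apex₂       = tt , tt
  adj-valid (apex₁-inner s≤D) = tt , s≤D
  adj-valid (apex₂-inner s≤D) = tt , s≤D
  adj-valid (inner-inner s<D) = <⇒≤ s<D , s<D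
  adj-valid apex₁-vx          = tt , tt
  adj-valid inner-vx          = ≤-refl , tt
  adj-valid inner-vy          = z≤n , tt
  adj-valid apex₂-vy          = tt , tt

  adjacent-valid : Adjacent D u v → Valid D u × Valid D v
  adjacent-valid (inj₁ a) = adj-valid a
  adjacent-valid (inj₂ a) = Product.swap (adj-valid a)

  adj-irreflexive : Adj D u v → u ≢ v
  adj-irreflexive () refl

  adjacent-irreflexive : Adjacent D u v → u ≢ v
  adjacent-irreflexive (inj₁ a) = adj-irreflexive a
  adjacent-irreflexive (inj₂ a) = adj-irreflexive a ∘ sym

  adjacent-sym : Adjacent D u v → Adjacent D v u
  adjacent-sym = Sum.swap

  diamond-flip : ∀ {c p q r} → Diamond D c p q r → Diamond D c r q p
  diamond-flip (diamond cp pq qc qr rc p≢r ¬pr) = diamond (adjacent-sym rc) (adjacent-sym qr) qc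
    (adjacent-sym pq) (adjacent-sym cp) (p≢r ∘ sym) (¬pr ∘ adjacent-sym)

  inner-diamond : ∀ {s} → suc (suc s) ≤ D → Diamond D apex₁ (inner (suc (suc s))) (inner (suc s)) (inner s)
  inner-diamond {s} s+2≤D = diamond (inj₁ (apex₁-inner s+2≤D)) (inj₂ (inner-inner s+2≤D))
    (inj₂ (apex₁-inner s+1≤D)) (inj₂ (inner-inner s+1≤D)) (inj₂ (apex₁-inner (<⇒≤ s+1≤D)))
    (λ ()) (λ { (inj₁ ()) ; (inj₂ ()) })
    where
    s+1≤D : suc s ≤ D
    s+1≤D = <⇒≤ s+2≤D

  apex-diamond : ∀ {s t} → s ≤ D → t ≤ D → inner t ≢ inner s → ¬ Adjacent D (inner t) (inner s) →
                 Diamond D apex₁ (inner t) apex₂ (inner s)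
  apex-diamond s≤D t≤D = diamond (inj₁ (apex₁-inner t≤D)) (inj₂ (apex₂-inner t≤D))
    (inj₂ apex₁-apex₂) (inj₁ (apex₂-inner s≤D)) (inj₂ (apex₁-inner s≤D))

  apex-gap-diamond : ∀ {s} → suc (suc s) ≤ D → Diamond D apex₁ (inner (suc (suc s))) apex₂ (inner s)
  apex-gap-diamond s+2≤D = apex-diamond (<⇒≤ (<⇒≤ s+2≤D)) s+2≤D (λ ()) (λ { (inj₁ ()) ; (inj₂ ()) })

  vx-diamond : Diamond D apex₁ vx (inner D) apex₂
  vx-diamond = diamond (inj₁ apex₁-vx) (inj₂ inner-vx) (inj₂ (apex₁-inner ≤-refl))
    (inj₂ (apex₂-inner ≤-refl)) (inj₂ apex₁-apex₂) (λ ()) (λ { (inj₁ ()) ; (inj₂ ()) })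

  vy-diamond : Diamond D apex₂ apex₁ (inner 0) vy
  vy-diamond = diamond (inj₂ apex₁-apex₂) (inj₁ (apex₁-inner z≤n)) (inj₂ (apex₂-inner z≤n))
    (inj₁ inner-vy) (inj₂ apex₂-vy) (λ ()) (λ { (inj₁ ()) ; (inj₂ ()) })

  final-diamond : 1 ≤ D → Diamond D apex₂ vy (inner 0) (inner 1)
  final-diamond 1≤D = diamond (inj₁ apex₂-vy) (inj₂ inner-vy) (inj₂ (apex₂-inner z≤n))
    (inj₁ (inner-inner 1≤D)) (inj₂ (apex₂-inner 1≤D)) (λ ()) (λ { (inj₁ ()) ; (inj₂ ()) })

end-diamond : ∀ {s} → Diamond (suc s) apex₁ (inner s) (inner (suc s)) vx
end-diamond = diamond (inj₁ (apex₁-inner (n≤1+n _))) (inj₁ (inner-inner ≤-refl))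
  (inj₂ (apex₁-inner ≤-refl)) (inj₁ inner-vx) (inj₂ apex₁-vx) (λ ()) (λ { (inj₁ ()) ; (inj₂ ()) })

module Decoding (h : ℕ) where

  n D : ℕ
  n = suc (suc h)
  D = twice (suc h)

  2n≡ : 2 * n ≡ suc (suc D)
  2n≡ = 2*≡twice n

  2n+1≡ : 2 * n + 1 ≡ suc (suc (suc D))
  2n+1≡ = trans (cong (_+ 1) 2n≡) (cong (suc ∘ suc) (+-comm D 1))

  toLabel : Vertex → Label
  toLabel apex₁     = num 1
  toLabel apex₂     = num (suc (suc (suc D)))
  toLabel (inner s) = num (suc (suc s))
  toLabel vx        = lx
  toLabel vy        = ly

  numbered : ℕ → Vertex
  numbered zero = apex₁
  numbered (suc s) with s ≟ suc D
  ... | yes _ = apex₂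
  ... | no _  = inner s

  vertexAt : ℕ → Vertex
  vertexAt t with t ≤? 2 * n
  ... | yes _ = numbered t
  ... | no _ with t ≟ suc (2 * n)
  ...   | yes _ = vx
  ...   | no _  = vy

  label≡toLabel : ∀ k → label n k ≡ toLabel (vertexAt (toℕ k))
  label≡toLabel k with toℕ k ≤? 2 * n
  ... | no _ with toℕ k ≟ suc (2 * n)
  ...   | yes _ = refl
  ...   | no _  = refl
  label≡toLabel k | yes _ with toℕ k
  ... | zero = refl
  ... | suc s with s ≟ suc D
  ...   | yes refl = refl
  ...   | no _     = refl

  vertex : Fin (2 * n + 3) → Vertex
  vertex k = vertexAt (toℕ k)

  index : Vertex → ℕ
  index apex₁     = 0
  index (inner s) = suc s
  index apex₂     = suc (suc D)
  index vx        = suc (suc (suc D))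
  index vy        = suc (suc (suc (suc D)))

  valid-vertexAt : ∀ t → Valid D (vertexAt t)
  valid-vertexAt t with t ≤? 2 * n
  ... | no _ with t ≟ suc (2 * n)
  ...   | yes _ = tt
  ...   | no _  = tt
  valid-vertexAt t | yes t≤2n with t
  ... | zero = tt
  ... | suc s with s ≟ suc D
  ...   | yes _   = tt
  ...   | no s≢ = ≤-pred (≤∧≢⇒< (≤-pred (subst (suc s ≤_) 2n≡ t≤2n)) s≢)

  index-vertexAt : ∀ t → t < 2 * n + 3 → index (vertexAt t) ≡ t
  index-vertexAt t t<N with t ≤? 2 * n
  ... | no t≰2n with t ≟ suc (2 * n)
  ...   | yes refl = cong suc (sym 2n≡)
  ...   | no t≢    = trans (cong (suc ∘ suc) (sym 2n≡)) (≤-antisym 2n+2≤t t≤2n+2)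
    where
    2n+2≤t : suc (suc (2 * n)) ≤ t
    2n+2≤t = ≤∧≢⇒< (≰⇒> t≰2n) (t≢ ∘ sym)
    t≤2n+2 : t ≤ suc (suc (2 * n))
    t≤2n+2 = ≤-pred (subst (t <_) (+-comm (2 * n) 3) t<N)
  index-vertexAt t t<N | yes _ with t
  ... | zero = refl
  ... | suc s with s ≟ suc D
  ...   | yes refl = refl
  ...   | no _     = refl

  vertex-injective : ∀ k k' → vertex k ≡ vertex k' → k ≡ k'
  vertex-injective k k' eq = toℕ-injective (begin
    toℕ k                    ≡⟨ index-vertexAt (toℕ k) (toℕ<n k) ⟨
    index (vertex k)         ≡⟨ cong index eq ⟩
    index (vertex k')        ≡⟨ index-vertexAt (toℕ k') (toℕ<n k') ⟩
    toℕ k'                   ∎)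
    where open ≡-Reasoning

  vertexAt-index : ∀ v → Valid D v → vertexAt (index v) ≡ v
  vertexAt-index apex₁ _ = refl
  vertexAt-index (inner s) s≤D with suc s ≤? 2 * n
  ... | no s≰2n = ⊥-elim (s≰2n (subst (suc s ≤_) (sym 2n≡) (s≤s (m≤n⇒m≤1+n s≤D))))
  ... | yes _ with s ≟ suc D
  ...   | yes refl = ⊥-elim (n≮n D s≤D)
  ...   | no _     = refl
  vertexAt-index apex₂ _ with suc (suc D) ≤? 2 * n
  ... | no ≰2n = ⊥-elim (≰2n (subst (suc (suc D) ≤_) (sym 2n≡) ≤-refl))
  ... | yes _ with suc D ≟ suc D
  ...   | yes _ = refl
  ...   | no neq = ⊥-elim (neq refl)
  vertexAt-index vx _ with suc (suc (suc D)) ≤? 2 * n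
  ... | yes ≤2n = ⊥-elim (n≮n _ (subst (suc (suc (suc D)) ≤_) 2n≡ ≤2n))
  ... | no _ with suc (suc (suc D)) ≟ suc (2 * n)
  ...   | yes _ = refl
  ...   | no neq = ⊥-elim (neq (cong suc (sym 2n≡)))
  vertexAt-index vy _ with suc (suc (suc (suc D))) ≤? 2 * n
  ... | yes ≤2n = ⊥-elim (n≮n _ (≤-trans (n≤1+n _) (subst (suc (suc (suc (suc D))) ≤_) 2n≡ ≤2n)))
  ... | no _ with suc (suc (suc (suc D))) ≟ suc (2 * n)
  ...   | yes eq = ⊥-elim (1+n≢n (trans eq (cong suc 2n≡)))
  ...   | no _  = refl

  index<N : ∀ v → Valid D v → index v < 2 * n + 3
  index<N v valid = subst (index v <_) (sym N≡) (s≤s (bound v valid))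
    where
    N≡ : 2 * n + 3 ≡ 5 + D
    N≡ = trans (+-comm (2 * n) 3) (cong (3 +_) 2n≡)
    bound : ∀ v → Valid D v → index v ≤ 4 + D
    bound apex₁     _   = z≤n
    bound (inner s) s≤D = s≤s (m≤n⇒m≤o+n 3 s≤D)
    bound apex₂     _   = s≤s (s≤s (m≤n+m D 2))
    bound vx        _   = n≤1+n _
    bound vy        _   = ≤-refl

  -- ⌜ v ⌝ is the vertex v of G4 n; vertices outside the graph are sent to a junk value.
  ⌜_⌝ : Vertex → Fin (2 * n + 3)
  ⌜ v ⌝ with index v <? 2 * n + 3
  ... | yes i<N = fromℕ< i<N
  ... | no _    = Fin.zero

  vertex-⌜⌝ : ∀ v → Valid D v → vertex ⌜ v ⌝ ≡ v
  vertex-⌜⌝ v valid with index v <? 2 * n + 3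
  ... | yes i<N = trans (cong vertexAt (toℕ-fromℕ< i<N)) (vertexAt-index v valid)
  ... | no i≮N  = ⊥-elim (i≮N (index<N v valid))

  decode-apex₁ : ∀ {u} → toLabel u ≡ num 1 → u ≡ apex₁
  decode-apex₁ {apex₁} _ = refl

  decode-apex₂ : ∀ {u} → Valid D u → toLabel u ≡ num (2 * n + 1) → u ≡ apex₂
  decode-apex₂ {u} valid eq with trans eq (cong num 2n+1≡)
  decode-apex₂ {apex₂}   _   _ | _    = refl
  decode-apex₂ {inner s} s≤D _ | refl = ⊥-elim (n≮n D s≤D)

  decode-inner : ∀ {u s} → Valid D u → toLabel u ≡ num (suc (suc s)) → s ≤ D → u ≡ inner s
  decode-inner {apex₂}   _ refl s≤D = ⊥-elim (n≮n D s≤D)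
  decode-inner {inner _} _ refl _   = refl

  decode-vx : ∀ {u} → toLabel u ≡ lx → u ≡ vx
  decode-vx {vx} _ = refl

  decode-vy : ∀ {u} → toLabel u ≡ ly → u ≡ vy
  decode-vy {vy} _ = refl

  private
    inner≤2n : ∀ {s} → s ≤ D → suc (suc s) ≤ 2 * n
    inner≤2n {s} s≤D = subst (suc (suc s) ≤_) (sym 2n≡) (s≤s (s≤s s≤D))

    2n≤-inner : ∀ {s} → suc (suc s) ≤ 2 * n → s ≤ D
    2n≤-inner {s} bound = ≤-pred (≤-pred (subst (suc (suc s) ≤_) 2n≡ bound))

    path-bound : ∀ {s} → suc (suc s) ≤ 2 * n ∸ 1 → suc s ≤ D
    path-bound {s} bound = ≤-pred (subst (suc (suc s) ≤_) (cong (_∸ 1) 2n≡) bound)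

  adj⇒baseEdge : ∀ {u v} → Adj D u v → BaseEdge n (toLabel u) (toLabel v)
  adj⇒baseEdge apex₁-apex₂ = subst (BaseEdge n (num 1) ∘ num) 2n+1≡ one-top
  adj⇒baseEdge (apex₁-inner s≤D) = one _ (s≤s (s≤s z≤n)) (inner≤2n s≤D)
  adj⇒baseEdge (apex₂-inner {s} s≤D) =
    subst (λ t → BaseEdge n (num t) (num (suc (suc s)))) 2n+1≡ (top _ (s≤s (s≤s z≤n)) (inner≤2n s≤D))
  adj⇒baseEdge (inner-inner {s} s<D) =
    path _ (s≤s (s≤s z≤n)) (subst (suc (suc s) ≤_) (sym (cong (_∸ 1) 2n≡)) (s≤s s<D))
  adj⇒baseEdge apex₁-vx = one-x
  adj⇒baseEdge inner-vx = subst (λ t → BaseEdge n (num t) lx) 2n≡ twon-x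
  adj⇒baseEdge inner-vy = two-y
  adj⇒baseEdge apex₂-vy = subst (λ t → BaseEdge n (num t) ly) 2n+1≡ top-y

  baseEdge⇒adj : ∀ {u v l l'} → Valid D u → Valid D v → toLabel u ≡ l → toLabel v ≡ l' →
                 BaseEdge n l l' → Adj D u v
  baseEdge⇒adj vu vv eu ev (path _ (s≤s (s≤s z≤n)) bound)
    with decode-inner vu eu (<⇒≤ (path-bound bound)) | decode-inner vv ev (path-bound bound)
  ... | refl | refl = inner-inner (path-bound bound)
  baseEdge⇒adj vu vv eu ev (one _ (s≤s (s≤s z≤n)) bound)
    with decode-apex₁ eu | decode-inner vv ev (2n≤-inner bound)
  ... | refl | refl = apex₁-inner (2n≤-inner bound)
  baseEdge⇒adj vu vv eu ev (top _ (s≤s (s≤s z≤n)) bound)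
    with decode-apex₂ vu eu | decode-inner vv ev (2n≤-inner bound)
  ... | refl | refl = apex₂-inner (2n≤-inner bound)
  baseEdge⇒adj vu vv eu ev one-top with decode-apex₁ eu | decode-apex₂ vv ev
  ... | refl | refl = apex₁-apex₂
  baseEdge⇒adj vu vv eu ev one-x with decode-apex₁ eu | decode-vx ev
  ... | refl | refl = apex₁-vx
  baseEdge⇒adj vu vv eu ev twon-x with decode-inner vu (trans eu (cong num 2n≡)) ≤-refl | decode-vx ev
  ... | refl | refl = inner-vx
  baseEdge⇒adj vu vv eu ev two-y with decode-inner vu eu z≤n | decode-vy ev
  ... | refl | refl = inner-vy
  baseEdge⇒adj vu vv eu ev top-y with decode-apex₂ vu eu | decode-vy ev
  ... | refl | refl = apex₂-vy

  edge⇔adjacent : ∀ k k' → E (G4 n) k k' ⇔ Adjacent D (vertex k) (vertex k')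
  edge⇔adjacent k k' = mk⇔ (Sum.map (decode k k') (decode k' k)) (Sum.map (encode k k') (encode k' k))
    where
    decode : ∀ k k' → BaseEdge n (label n k) (label n k') → Adj D (vertex k) (vertex k')
    decode k k' = baseEdge⇒adj (valid-vertexAt (toℕ k)) (valid-vertexAt (toℕ k'))
                               (sym (label≡toLabel k)) (sym (label≡toLabel k'))
    encode : ∀ k k' → Adj D (vertex k) (vertex k') → BaseEdge n (label n k) (label n k')
    encode k k' = subst₂ (BaseEdge n) (sym (label≡toLabel k)) (sym (label≡toLabel k')) ∘ adj⇒baseEdge

  edge⌜⌝⇔adjacent : ∀ {a b} → Valid D a → Valid D b → E (G4 n) ⌜ a ⌝ ⌜ b ⌝ ⇔ Adjacent D a b
  edge⌜⌝⇔adjacent {a} {b} va vb =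
    subst₂ (λ x y → E (G4 n) ⌜ a ⌝ ⌜ b ⌝ ⇔ Adjacent D x y) (vertex-⌜⌝ a va) (vertex-⌜⌝ b vb)
           (edge⇔adjacent ⌜ a ⌝ ⌜ b ⌝)

module NonRepresentability (k : ℕ) where

  open Decoding (suc k)

  ⌜⌝-injective : ∀ {a b} → Valid D a → Valid D b → ⌜ a ⌝ ≡ ⌜ b ⌝ → a ≡ b
  ⌜⌝-injective {a} {b} va vb eq =
    trans (sym (vertex-⌜⌝ a va)) (trans (cong vertex eq) (vertex-⌜⌝ b vb))

  separated : ∀ {a b} → Valid D a → Valid D b → a ≢ b → ⌜ a ⌝ ≢ ⌜ b ⌝
  separated va vb a≢b = a≢b ∘ ⌜⌝-injective va vb

  apart : ∀ {a b} → Adjacent D a b → ⌜ a ⌝ ≢ ⌜ b ⌝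
  apart ab = separated (proj₁ (adjacent-valid ab)) (proj₂ (adjacent-valid ab)) (adjacent-irreflexive ab)

  module _ (w : List (Fin (2 * n + 3)))
           (represents : ∀ i j → i ≢ j → E (G4 n) i j ⇔ Alternate Fin._≟_ i j w)
           (O : CompatibleCyclicOrder (λ i j → Alternate Fin._≟_ i j w)) where

    open CompatibleCyclicOrder O

    σ : Vertex → Vertex → Vertex → Set
    σ a b c = Cyc ⌜ a ⌝ ⌜ b ⌝ ⌜ c ⌝

    Alt : Vertex → Vertex → Set
    Alt a b = Alternate Fin._≟_ ⌜ a ⌝ ⌜ b ⌝ w

    adjacent⇔alt : ∀ {a b} → Valid D a → Valid D b → a ≢ b → Adjacent D a b ⇔ Alt a b
    adjacent⇔alt va vb a≢b =
      ⇔.trans (⇔.sym (edge⌜⌝⇔adjacent va vb)) (represents _ _ (separated va vb a≢b))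

    alt : ∀ {a b} → Adjacent D a b → Alt a b
    alt ab with adjacent-valid ab
    ... | va , vb = Equivalence.to (adjacent⇔alt va vb (adjacent-irreflexive ab)) ab

    diamond-closes : ∀ {c p q r} → Diamond D c p q r → σ c p q → σ c q r → ⊥
    diamond-closes (diamond cp pq qc qr rc p≢r ¬pr) cpq cqr =
      ¬pr (Equivalence.from (adjacent⇔alt (proj₁ (adjacent-valid pq)) (proj₂ (adjacent-valid qr)) p≢r)
             (closes cpq cqr (alt cp) (alt pq) (alt qc) (alt qr) (alt rc)))

    pivot-left : ∀ {c p q r} → Diamond D c p q r → σ c p q → σ c r q
    pivot-left d@(diamond _ _ qc qr rc _ _) cpq with total (apart qc ∘ sym) (apart qr) (apart rc ∘ sym)
    ... | inj₁ cqr = ⊥-elim (diamond-closes d cpq cqr)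
    ... | inj₂ crq = crq

    pivot-right : ∀ {c p q r} → Diamond D c p q r → σ c q r → σ c q p
    pivot-right d@(diamond cp pq qc _ _ _ _) cqr with total (apart cp) (apart pq) (apart qc ∘ sym)
    ... | inj₁ cpq = ⊥-elim (diamond-closes d cpq cqr)
    ... | inj₂ cqp = cqp

    zigzag-down : ∀ j → twice (suc j) ≤ D →
                  σ apex₁ (inner (twice (suc j))) (inner (suc (twice j))) → σ apex₁ (inner 2) (inner 1)
    zigzag-down zero    _     zig = zig
    zigzag-down (suc j) bound zig =
      zigzag-down j (≤-trans (n≤1+n _) (≤-trans (n≤1+n _) bound))
        (pivot-right (diamond-flip (inner-diamond (≤-trans (n≤1+n _) bound)))
          (pivot-left (inner-diamond bound) zig))

    apex₂-down : ∀ j → twice j ≤ D → σ apex₁ (inner (twice j)) apex₂ → σ apex₁ (inner 0) apex₂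
    apex₂-down zero    _     h = h
    apex₂-down (suc j) bound h =
      apex₂-down j (≤-trans (n≤1+n _) (≤-trans (n≤1+n _) bound)) (pivot-left (apex-gap-diamond bound) h)

    no-orientation : σ apex₁ (inner D) apex₂ → ⊥
    no-orientation aDb = diamond-closes (final-diamond (s≤s z≤n)) by0 b01
      where
      a01 : σ apex₁ (inner 0) (inner 1)
      a01 = pivot-left (inner-diamond (s≤s (s≤s z≤n)))
              (zigzag-down (suc k) ≤-refl (pivot-right end-diamond (pivot-right vx-diamond aDb)))
      a1b : σ apex₁ (inner 1) apex₂
      a1b = pivot-left (apex-diamond (s≤s z≤n) ≤-refl (λ ()) (λ { (inj₁ ()) ; (inj₂ ()) })) aDb
      b01 : σ apex₂ (inner 0) (inner 1)
      b01 = rotate (rotate (transitive a01 a1b))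
      by0 : σ apex₂ vy (inner 0)
      by0 = pivot-left vy-diamond (rotate (rotate (apex₂-down (suc (suc k)) ≤-refl aDb)))

  not-word-representable : ¬ WordRepresentable (G4 n)
  not-word-representable (w , represents) = orient (first-occurrence-order Fin._≟_ w (allFin _) ∈-allFin)
    where
    orient : CompatibleCyclicOrder (λ i j → Alternate Fin._≟_ i j w) → ⊥
    orient O with CompatibleCyclicOrder.total O (apart (inj₁ (apex₁-inner ≤-refl)))
                    (apart (inj₂ (apex₂-inner ≤-refl))) (apart (inj₁ apex₁-apex₂))
    ... | inj₁ aDb = no-orientation w represents O aDb
    ... | inj₂ abD = no-orientation w represents (reversed (Words.alternate-sym Fin._≟_ w) O) abD

-- Representations of the vertex-deleted subgraphs

filter-reverse : ∀ {A : Set} {P : A → Set} (P? : Decidable P) xs →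
                 filter P? (reverse xs) ≡ reverse (filter P? xs)
filter-reverse P? [] = refl
filter-reverse P? (x ∷ xs) with P? x
... | yes px = begin
  filter P? (reverse (x ∷ xs))                 ≡⟨ cong (filter P?) (unfold-reverse x xs) ⟩
  filter P? (reverse xs ++ x ∷ [])             ≡⟨ filter-++ P? (reverse xs) _ ⟩
  filter P? (reverse xs) ++ filter P? (x ∷ []) ≡⟨ cong₂ _++_ (filter-reverse P? xs) (filter-accept P? px) ⟩
  reverse (filter P? xs) ∷ʳ x                  ≡⟨ unfold-reverse x (filter P? xs) ⟨
  reverse (x ∷ filter P? xs)                   ∎
  where open ≡-Reasoning
... | no ¬px = begin
  filter P? (reverse (x ∷ xs))                 ≡⟨ cong (filter P?) (unfold-reverse x xs) ⟩
  filter P? (reverse xs ++ x ∷ [])             ≡⟨ filter-++ P? (reverse xs) _ ⟩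
  filter P? (reverse xs) ++ filter P? (x ∷ []) ≡⟨ cong₂ _++_ (filter-reverse P? xs) (filter-reject P? ¬px) ⟩
  reverse (filter P? xs) ++ []                 ≡⟨ ++-identityʳ _ ⟩
  reverse (filter P? xs)                       ∎
  where open ≡-Reasoning

Crossing Aligned : ℕ × ℕ → ℕ × ℕ → Set
Crossing k l = (proj₁ k < proj₁ l × proj₂ l < proj₂ k) ⊎ (proj₁ l < proj₁ k × proj₂ k < proj₂ l)
Aligned  k l = (proj₁ k < proj₁ l × proj₂ k < proj₂ l) ⊎ (proj₁ l < proj₁ k × proj₂ l < proj₂ k)

module TwoPermutations {A : Set} (_≟_ : DecidableEquality A) (letters : List A)
                       (unique : Unique letters) (complete : ∀ a → a ∈ letters) where

  open Words _≟_ using (restrict-++; restrict-kept; restrict-dropped; restrict-sym; alternate-sym)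

  private
    R : A → A → List A → List A
    R = restrict _≟_

  layer : (A → ℕ) → ℕ → List A
  layer key t = filter (λ a → key a ℕ.≟ t) letters

  ascending : (A → ℕ) → ℕ → List A
  ascending key zero    = []
  ascending key (suc t) = ascending key t ++ layer key t

  occurs-once : ∀ {a xs} → Unique xs → a ∈ xs → filter (_≟ a) xs ≡ a ∷ []
  occurs-once {a} {x ∷ xs} (x≢xs ∷ _) (here refl) =
    trans (filter-accept (_≟ a) refl) (cong (a ∷_) (filter-none (_≟ a) (All.map (_∘ sym) x≢xs)))
  occurs-once {a} {x ∷ xs} (x≢xs ∷ uniq) (there a∈xs) with x ≟ a
  ... | yes refl = ⊥-elim (All.lookup x≢xs a∈xs refl)
  ... | no _     = occurs-once uniq a∈xs

  module _ (key : A → ℕ) where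

    restrict-layer-key : ∀ {i j t} xs → key i ≡ t → key j ≢ t →
                         R i j (filter (λ a → key a ℕ.≟ t) xs) ≡ filter (_≟ i) xs
    restrict-layer-key [] _ _ = refl
    restrict-layer-key {i} {j} {t} (u ∷ xs) it jt = step (key u ℕ.≟ t) (u ≟ i)
      where
      open ≡-Reasoning
      at? : ∀ a → Dec (key a ≡ t)
      at? a = key a ℕ.≟ t
      IH : R i j (filter at? xs) ≡ filter (_≟ i) xs
      IH = restrict-layer-key xs it jt
      step : Dec (key u ≡ t) → Dec (u ≡ i) → R i j (filter at? (u ∷ xs)) ≡ filter (_≟ i) (u ∷ xs)
      step (yes ut) (yes refl) = begin
        R i j (filter at? (u ∷ xs))   ≡⟨ cong (R i j) (filter-accept at? ut) ⟩
        R i j (u ∷ filter at? xs)     ≡⟨ restrict-kept i j _ (here refl) ⟩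
        u ∷ R i j (filter at? xs)     ≡⟨ cong (u ∷_) IH ⟩
        u ∷ filter (_≟ i) xs          ≡⟨ filter-accept (_≟ i) refl ⟨
        filter (_≟ i) (u ∷ xs)        ∎
      step (yes ut) (no u≢i) = begin
        R i j (filter at? (u ∷ xs))   ≡⟨ cong (R i j) (filter-accept at? ut) ⟩
        R i j (u ∷ filter at? xs)     ≡⟨ restrict-dropped i j _ (λ { (here u≡i) → u≢i u≡i
                                                                    ; (there (here refl)) → jt ut }) ⟩
        R i j (filter at? xs)         ≡⟨ IH ⟩
        filter (_≟ i) xs              ≡⟨ filter-reject (_≟ i) u≢i ⟨
        filter (_≟ i) (u ∷ xs)        ∎
      step (no ¬ut) _ = begin
        R i j (filter at? (u ∷ xs))   ≡⟨ cong (R i j) (filter-reject at? ¬ut) ⟩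
        R i j (filter at? xs)         ≡⟨ IH ⟩
        filter (_≟ i) xs              ≡⟨ filter-reject (_≟ i) (λ { refl → ¬ut it }) ⟨
        filter (_≟ i) (u ∷ xs)        ∎

    layer-first : ∀ {i j t} → key i ≡ t → key j ≢ t → R i j (layer key t) ≡ i ∷ []
    layer-first {i} it jt = trans (restrict-layer-key letters it jt) (occurs-once unique (complete i))

    layer-second : ∀ {i j t} → key j ≡ t → key i ≢ t → R i j (layer key t) ≡ j ∷ []
    layer-second {i} {j} {t} jt it = trans (restrict-sym i j (layer key t)) (layer-first jt it)

    layer-neither : ∀ {i j t} → key i ≢ t → key j ≢ t → R i j (layer key t) ≡ []
    layer-neither {i} {j} {t} it jt =
      filter-none (λ c → (c ≟ i) ⊎-dec (c ≟ j)) {layer key t} (All.tabulate λ a∈layer →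
        let at = proj₂ (∈-filter⁻ (λ a → key a ℕ.≟ t) {xs = letters} a∈layer) in
        [ (λ { refl → it at }) , (λ { refl → jt at }) ]′)

    private
      extend : ∀ {i j} t {xs ys} → R i j (ascending key t) ≡ xs → R i j (layer key t) ≡ ys →
               R i j (ascending key (suc t)) ≡ xs ++ ys
      extend {i} {j} t e₁ e₂ = trans (restrict-++ i j (ascending key t) (layer key t)) (cong₂ _++_ e₁ e₂)

    module _ {i j : A} (i<j : key i < key j) where

      ascending-before : ∀ t → t ≤ key i → R i j (ascending key t) ≡ []
      ascending-before zero    _   = refl
      ascending-before (suc t) t<i =
        extend t (ascending-before t (<⇒≤ t<i))
                 (layer-neither (<⇒≢ t<i ∘ sym) (<⇒≢ (<-trans t<i i<j) ∘ sym))

      ascending-between : ∀ t → key i < t → t ≤ key j → R i j (ascending key t) ≡ i ∷ []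
      ascending-between (suc t) i<1+t t<j with m≤n⇒m<n∨m≡n (≤-pred i<1+t)
      ... | inj₁ i<t = extend t (ascending-between t i<t (<⇒≤ t<j))
                                (layer-neither (<⇒≢ i<t) (<⇒≢ t<j ∘ sym))
      ... | inj₂ i≡t = extend t (ascending-before t (≤-reflexive (sym i≡t)))
                                (layer-first i≡t (<⇒≢ t<j ∘ sym))

      ascending-after : ∀ t → key j < t → R i j (ascending key t) ≡ i ∷ j ∷ []
      ascending-after (suc t) j<1+t with m≤n⇒m<n∨m≡n (≤-pred j<1+t)
      ... | inj₁ j<t = extend t (ascending-after t j<t)
                                (layer-neither (<⇒≢ (<-trans i<j j<t)) (<⇒≢ j<t))
      ... | inj₂ refl = extend t (ascending-between t i<j ≤-refl) (layer-second refl (<⇒≢ i<j))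

  module Word (keys : A → ℕ × ℕ) (M : ℕ)
              (bounded : ∀ a → proj₁ (keys a) < M × proj₂ (keys a) < M) where

    private
      π₁ π₂ : List A
      π₁ = ascending (proj₁ ∘ keys) M
      π₂ = ascending (proj₂ ∘ keys) M

    word : List A
    word = π₁ ++ reverse π₂

    private
      restrict-word : ∀ {i j xs ys} → R i j π₁ ≡ xs → R i j π₂ ≡ ys → R i j word ≡ xs ++ reverse ys
      restrict-word {i} {j} e₁ e₂ = begin
        R i j word                       ≡⟨ restrict-++ i j π₁ (reverse π₂) ⟩
        R i j π₁ ++ R i j (reverse π₂)   ≡⟨ cong (R i j π₁ ++_)
                                                (filter-reverse (λ c → (c ≟ i) ⊎-dec (c ≟ j)) π₂) ⟩
        R i j π₁ ++ reverse (R i j π₂)   ≡⟨ cong₂ (λ u v → u ++ reverse v) e₁ e₂ ⟩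
        _                                ∎
        where open ≡-Reasoning

      no-repeat : ∀ {i j a : A} → i ≢ j → ¬ HasFactor a a (i ∷ j ∷ i ∷ j ∷ [])
      no-repeat i≢j ([]                    , _ , refl) = i≢j refl
      no-repeat i≢j (_ ∷ []                , _ , refl) = i≢j refl
      no-repeat i≢j (_ ∷ _ ∷ []            , _ , refl) = i≢j refl
      no-repeat i≢j (_ ∷ _ ∷ _ ∷ []        , _ , ())
      no-repeat i≢j (_ ∷ _ ∷ _ ∷ _ ∷ []    , _ , ())
      no-repeat i≢j (_ ∷ _ ∷ _ ∷ _ ∷ _ ∷ _ , _ , ())

    crossing⇒alternate : ∀ {i j} → Crossing (keys i) (keys j) → Alternate _≟_ i j word
    crossing⇒alternate {i} {j} (inj₁ (i<j , j<i)) =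
      no-repeat i≢j ∘ subst (HasFactor i i) ijij , no-repeat i≢j ∘ subst (HasFactor j j) ijij
      where
      i≢j : i ≢ j
      i≢j refl = <-irrefl refl i<j
      ijij : R i j word ≡ i ∷ j ∷ i ∷ j ∷ []
      ijij = restrict-word (ascending-after (proj₁ ∘ keys) i<j M (proj₁ (bounded j)))
                           (trans (restrict-sym i j π₂)
                                  (ascending-after (proj₂ ∘ keys) j<i M (proj₂ (bounded i))))
    crossing⇒alternate {i} {j} (inj₂ ji) = alternate-sym word (crossing⇒alternate {j} {i} (inj₁ ji))

    aligned⇒¬alternate : ∀ {i j} → Aligned (keys i) (keys j) → ¬ Alternate _≟_ i j word
    aligned⇒¬alternate {i} {j} (inj₁ (i<j , i<j′)) (_ , no-jj) =
      no-jj (i ∷ [] , i ∷ [] , restrict-word (ascending-after (proj₁ ∘ keys) i<j M (proj₁ (bounded j)))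
                                             (ascending-after (proj₂ ∘ keys) i<j′ M (proj₂ (bounded j))))
    aligned⇒¬alternate {i} {j} (inj₂ ji) = aligned⇒¬alternate {j} {i} (inj₁ ji) ∘ alternate-sym word

module _ {V : Set} (S : V → Bool) where

  present : List V → List (Σ V (T ∘ S))
  present []       = []
  present (u ∷ us) with T? (S u)
  ... | yes p = (u , p) ∷ present us
  ... | no _  = present us

  present⁻ : ∀ {v q us} → (v , q) ∈ present us → v ∈ us
  present⁻ {us = u ∷ us} v∈ with T? (S u) | v∈
  ... | yes _ | here eq   = here (cong proj₁ eq)
  ... | yes _ | there v∈′ = there (present⁻ v∈′)
  ... | no _  | v∈′       = there (present⁻ v∈′)

  present-unique : ∀ {us} → Unique us → Unique (present us)
  present-unique {[]}     [] = []
  present-unique {u ∷ us} (u∉ ∷ uniq) with T? (S u)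
  ... | yes _ = All.tabulate (λ v∈ eq → All.lookup u∉ (present⁻ v∈) (cong proj₁ eq))
              ∷ present-unique uniq
  ... | no _  = present-unique uniq

  ∈-present : ∀ {u us} (p : T (S u)) → u ∈ us → (u , p) ∈ present us
  ∈-present {u} {u ∷ us} p (here refl) with T? (S u)
  ... | yes q = here (cong (u ,_) (T-irrelevant p q))
  ... | no ¬p = ⊥-elim (¬p p)
  ∈-present {u} {v ∷ us} p (there u∈us) with T? (S v)
  ... | yes _ = there (∈-present p u∈us)
  ... | no _  = ∈-present p u∈us

≤-num : ∀ {m n} → True (m ≤? n) → m ≤ n
≤-num = toWitness

<-num : ∀ {m n} → True (m <? n) → m < n
<-num = toWitness

num<num+ : ∀ {a} c x → True (a <? c) → a < c + x
num<num+ c x a<c = <-≤-trans (<-num a<c) (m≤m+n c x)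

+-num-< : ∀ x a b → True (a <? b) → a + x < b + x
+-num-< x a b a<b = +-monoˡ-< x (<-num a<b)

+-num-≤ : ∀ x a b → True (a ≤? b) → a + x ≤ b + x
+-num-≤ x a b a≤b = +-monoˡ-≤ x (≤-num a≤b)

slot : ℕ → ℕ
slot zero    = 4
slot (suc s) = 4 + slot s

slot-mono : ∀ {s t} → s ≤ t → slot s ≤ slot t
slot-mono {zero}  {zero}  _         = ≤-refl
slot-mono {zero}  {suc t} _         = ≤-trans (slot-mono {zero} {t} z≤n) (m≤n+m (slot t) 4)
slot-mono {suc s} {suc t} (s≤s s≤t) = +-monoʳ-≤ 4 (slot-mono s≤t)

slot-≥4 : ∀ s → 4 ≤ slot s
slot-≥4 s = slot-mono {0} {s} z≤n

shift : ℕ × ℕ → ℕ × ℕ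
shift (k₁ , k₂) = 8 + k₁ , 8 + k₂

-- The keys of inner s before (true) or after (false) the cut: they lie in [slot s, slot s + 10]
-- and zigzag so that exactly consecutive inner vertices cross, in opposite phases on the two
-- sides of the cut.
innerKeys : Bool → ℕ → ℕ × ℕ
innerKeys b     (suc (suc s)) = shift (innerKeys b s)
innerKeys true  0             = 12 , 4
innerKeys true  1             = 8  , 16
innerKeys false 0             = 6  , 14
innerKeys false 1             = 18 , 10

record Within (lo hi : ℕ) (k : ℕ × ℕ) : Set where
  constructor within
  field
    lo₁ : lo ≤ proj₁ k
    hi₁ : proj₁ k ≤ hi
    lo₂ : lo ≤ proj₂ k
    hi₂ : proj₂ k ≤ hi
open Within

within-shift : ∀ {lo hi k} → Within lo hi k → Within (8 + lo) (8 + hi) (shift k)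
within-shift (within a b c d) = within (+-monoʳ-≤ 8 a) (+-monoʳ-≤ 8 b) (+-monoʳ-≤ 8 c) (+-monoʳ-≤ 8 d)

before-window : ∀ s → Within (slot s) (8 + slot s) (innerKeys true s)
before-window 0             = within (≤-num _) (≤-num _) (≤-num _) (≤-num _)
before-window 1             = within (≤-num _) (≤-num _) (≤-num _) (≤-num _)
before-window (suc (suc s)) = within-shift (before-window s)

after-window : ∀ s → Within (2 + slot s) (10 + slot s) (innerKeys false s)
after-window 0             = within (≤-num _) (≤-num _) (≤-num _) (≤-num _)
after-window 1             = within (≤-num _) (≤-num _) (≤-num _) (≤-num _)
after-window (suc (suc s)) = within-shift (after-window s)

window : ∀ b s → Within (slot s) (10 + slot s) (innerKeys b s)
window true s with before-window s
... | within a b c d = within a (≤-trans b 8≤10) c (≤-trans d 8≤10)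
  where
  8≤10 : 8 + slot s ≤ 10 + slot s
  8≤10 = +-num-≤ (slot s) 8 10 _
window false s with after-window s
... | within a b c d = within (≤-trans (m≤n+m (slot s) 2) a) b (≤-trans (m≤n+m (slot s) 2) c) d

evenKeys : Bool → ℕ → ℕ × ℕ
evenKeys true  x = 8 + x , x
evenKeys false x = 2 + x , 10 + x

innerKeys-even : ∀ b j → innerKeys b (twice j) ≡ evenKeys b (slot (twice j))
innerKeys-even true  zero    = refl
innerKeys-even false zero    = refl
innerKeys-even true  (suc j) = cong shift (innerKeys-even true j)
innerKeys-even false (suc j) = cong shift (innerKeys-even false j)

crossing-shift : ∀ {k l} → Crossing k l → Crossing (shift k) (shift l)
crossing-shift (inj₁ (a , b)) = inj₁ (+-monoʳ-< 8 a , +-monoʳ-< 8 b)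
crossing-shift (inj₂ (a , b)) = inj₂ (+-monoʳ-< 8 a , +-monoʳ-< 8 b)

consecutive-crossing : ∀ b s → Crossing (innerKeys b s) (innerKeys b (suc s))
consecutive-crossing b     (suc (suc s)) = crossing-shift (consecutive-crossing b s)
consecutive-crossing true  0             = inj₂ (<-num _ , <-num _)
consecutive-crossing true  1             = inj₁ (<-num _ , <-num _)
consecutive-crossing false 0             = inj₁ (<-num _ , <-num _)
consecutive-crossing false 1             = inj₂ (<-num _ , <-num _)

gap-aligned : ∀ b s → Aligned (innerKeys b s) (innerKeys b (suc (suc s)))
gap-aligned b s = inj₁ (m<n+m _ (s≤s z≤n) , m<n+m _ (s≤s z≤n))

cut-aligned : ∀ s → Aligned (innerKeys true s) (innerKeys false (suc (suc s)))
cut-aligned s = inj₁ (≤-<-trans (hi₁ (before-window s)) (<-≤-trans gap (lo₁ (after-window (suc (suc s))))) ,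
                      ≤-<-trans (hi₂ (before-window s)) (<-≤-trans gap (lo₂ (after-window (suc (suc s))))))
  where
  gap : 8 + slot s < 10 + slot s
  gap = +-num-< (slot s) 8 10 _

far-aligned : ∀ b b' s {t} → suc (suc (suc s)) ≤ t → Aligned (innerKeys b s) (innerKeys b' t)
far-aligned b b' s {t} s+3≤t =
  inj₁ (≤-<-trans (hi₁ (window b s)) (<-≤-trans gap (≤-trans (slot-mono s+3≤t) (lo₁ (window b' t)))) ,
        ≤-<-trans (hi₂ (window b s)) (<-≤-trans gap (≤-trans (slot-mono s+3≤t) (lo₂ (window b' t)))))
  where
  gap : 10 + slot s < 12 + slot s
  gap = +-num-< (slot s) 10 12 _

data Deletion : Set where
  apex₁-or-vy apex₂-or-vx : Deletion
  inner-at : ℕ → Deletion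

deletion : Vertex → Deletion
deletion apex₁     = apex₁-or-vy
deletion vy        = apex₁-or-vy
deletion apex₂     = apex₂-or-vx
deletion vx        = apex₂-or-vx
deletion (inner s) = inner-at s

-- Whether inner s lies before the cut: deleting apex₁ or vy puts the whole path after it,
-- deleting apex₂ or vx before it.
before : Deletion → ℕ → Bool
before apex₁-or-vy  _ = false
before apex₂-or-vx  _ = true
before (inner-at c) s = does (s <? c)

Spared : Deletion → ℕ → Set
Spared (inner-at c) s = s ≢ c
Spared _            _ = ⊤

InRange : ℕ → Deletion → Set
InRange D (inner-at c) = c ≤ D
InRange D _            = ⊤

spared : ∀ {r s} → inner s ≢ r → Spared (deletion r) s
spared {apex₁}   _       = tt
spared {apex₂}   _       = tt
spared {vx}      _       = tt
spared {vy}      _       = tt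
spared {inner c} s≢c s≡c = s≢c (cong inner s≡c)

deletion-in-range : ∀ {D r} → Valid D r → InRange D (deletion r)
deletion-in-range {r = apex₁}   _   = tt
deletion-in-range {r = apex₂}   _   = tt
deletion-in-range {r = vx}      _   = tt
deletion-in-range {r = vy}      _   = tt
deletion-in-range {r = inner c} c≤D = c≤D

apex₁-vy-kept : ∀ {r} → apex₁ ≢ r → vy ≢ r → deletion r ≢ apex₁-or-vy
apex₁-vy-kept {apex₁}   apex₁≢r _ _ = apex₁≢r refl
apex₁-vy-kept {vy}      _ vy≢r _    = vy≢r refl
apex₁-vy-kept {apex₂}   _ _ ()
apex₁-vy-kept {vx}      _ _ ()
apex₁-vy-kept {inner _} _ _ ()

apex₂-vx-kept : ∀ {r} → apex₂ ≢ r → vx ≢ r → deletion r ≢ apex₂-or-vx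
apex₂-vx-kept {apex₂}   apex₂≢r _ _ = apex₂≢r refl
apex₂-vx-kept {vx}      _ vx≢r _    = vx≢r refl
apex₂-vx-kept {apex₁}   _ _ ()
apex₂-vx-kept {vy}      _ _ ()
apex₂-vx-kept {inner _} _ _ ()

before-suc : ∀ δ {s} → Spared δ (suc s) → before δ (suc s) ≡ before δ s
before-suc apex₁-or-vy _ = refl
before-suc apex₂-or-vx _ = refl
before-suc (inner-at c) {s} s+1≢c with s <? c
... | yes s<c = trans (dec-true (suc s <? c) (≤∧≢⇒< s<c s+1≢c)) (sym (dec-true (s <? c) s<c))
... | no s≮c  = trans (dec-false (suc s <? c) (s≮c ∘ <-trans (n<1+n s))) (sym (dec-false (s <? c) s≮c))

before-gap : ∀ δ {s} → before δ s ≡ false → before δ (suc (suc s)) ≡ false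
before-gap apex₁-or-vy _ = refl
before-gap (inner-at c) {s} s≮c = dec-false (suc (suc s) <? c) λ s+2<c →
  contradiction (trans (sym (dec-true (s <? c) (≤-trans (n≤1+n _) (≤-trans (n≤1+n _) s+2<c)))) s≮c) λ ()

before-last : ∀ {c D} → c ≤ D → before (inner-at c) D ≡ false
before-last {c} {D} c≤D = dec-false (D <? c) (λ D<c → <-irrefl refl (≤-<-trans c≤D D<c))

before-first : ∀ {c} → 0 ≢ c → before (inner-at c) 0 ≡ true
before-first {zero}  0≢0 = ⊥-elim (0≢0 refl)
before-first {suc c} _   = dec-true (0 <? suc c) (s≤s z≤n)

crossing-step : ∀ b b' s → b' ≡ b → Crossing (innerKeys b s) (innerKeys b' (suc s))
crossing-step b _ s refl = consecutive-crossing b s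

aligned-gap : ∀ b b' s → (b ≡ false → b' ≡ false) → Aligned (innerKeys b s) (innerKeys b' (suc (suc s)))
aligned-gap true  true  s _ = gap-aligned true s
aligned-gap false false s _ = gap-aligned false s
aligned-gap true  false s _ = cut-aligned s
aligned-gap false true  s f = contradiction (f refl) λ ()

-- The first keys of vx and vy follow the phase of inner D and inner 0, which makes vx cross
-- apex₂ (and vy cross apex₁) only when one of the two is deleted.
module Keys (m : ℕ) where

  D : ℕ
  D = twice m

  vx-first vy-first : Deletion → ℕ
  vx-first apex₂-or-vx = 7 + slot D
  vx-first _           = 14 + slot D
  vy-first apex₁-or-vy = 7
  vy-first _           = 1

  keys : Deletion → Vertex → ℕ × ℕ
  keys δ apex₁     = 2 , 12 + slot D
  keys δ apex₂     = 12 + slot D , 0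
  keys δ vx        = vx-first δ , 9 + slot D
  keys δ vy        = vy-first δ , 5
  keys δ (inner s) = innerKeys (before δ s) s

  data Realised (δ : Deletion) (u v : Vertex) : Set where
    edge     : Adjacent D u v → Crossing (keys δ u) (keys δ v) → Realised δ u v
    non-edge : ¬ Adjacent D u v → Aligned (keys δ u) (keys δ v) → Realised δ u v

  realised-sym : ∀ {δ u v} → Realised δ u v → Realised δ v u
  realised-sym (edge adj crossing)     = edge (Sum.swap adj) (Sum.swap crossing)
  realised-sym (non-edge ¬adj aligned) = non-edge (¬adj ∘ Sum.swap) (Sum.swap aligned)

  private
    vx-first-≥ : ∀ δ → 7 + slot D ≤ vx-first δ
    vx-first-≥ apex₁-or-vy  = +-num-≤ (slot D) 7 14 _
    vx-first-≥ apex₂-or-vx  = ≤-refl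
    vx-first-≥ (inner-at _) = +-num-≤ (slot D) 7 14 _

    vx-first-≤ : ∀ δ → vx-first δ ≤ 14 + slot D
    vx-first-≤ apex₁-or-vy  = ≤-refl
    vx-first-≤ apex₂-or-vx  = +-num-≤ (slot D) 7 14 _
    vx-first-≤ (inner-at _) = ≤-refl

    vy-first-≤ : ∀ δ → vy-first δ ≤ 7
    vy-first-≤ apex₁-or-vy  = ≤-refl
    vy-first-≤ apex₂-or-vx  = ≤-num _
    vy-first-≤ (inner-at _) = ≤-num _

    inner-below : ∀ b {s} → s ≤ D →
                  proj₁ (innerKeys b s) < 12 + slot D × proj₂ (innerKeys b s) < 12 + slot D
    inner-below b {s} s≤D = ≤-<-trans (hi₁ (window b s)) bound , ≤-<-trans (hi₂ (window b s)) bound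
      where
      bound : 10 + slot s < 12 + slot D
      bound = ≤-<-trans (+-monoʳ-≤ 10 (slot-mono s≤D)) (+-num-< (slot D) 10 12 _)

    inner-above : ∀ b s {k} → k < slot s → k < proj₁ (innerKeys b s) × k < proj₂ (innerKeys b s)
    inner-above b s k<slot = <-≤-trans k<slot (lo₁ (window b s)) , <-≤-trans k<slot (lo₂ (window b s))

    0<slot : ∀ s → 0 < slot s
    0<slot s = ≤-trans (s≤s z≤n) (slot-≥4 s)

  realised-apex₁-apex₂ : ∀ δ → Realised δ apex₁ apex₂
  realised-apex₁-apex₂ δ = edge (inj₁ apex₁-apex₂) (inj₁ (num<num+ 12 (slot D) _ , num<num+ 12 (slot D) _))

  realised-apex₁-inner : ∀ δ {s} → s ≤ D → Realised δ apex₁ (inner s)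
  realised-apex₁-inner δ {s} s≤D = edge (inj₁ (apex₁-inner s≤D))
    (inj₁ (proj₁ (inner-above (before δ s) s (<-≤-trans (<-num _) (slot-≥4 s))) ,
           proj₂ (inner-below (before δ s) s≤D)))

  realised-apex₁-vx : ∀ δ → Realised δ apex₁ vx
  realised-apex₁-vx δ = edge (inj₁ apex₁-vx)
    (inj₁ (<-≤-trans (num<num+ 7 (slot D) _) (vx-first-≥ δ) , +-num-< (slot D) 9 12 _))

  realised-apex₁-vy : ∀ δ → δ ≢ apex₁-or-vy → Realised δ apex₁ vy
  realised-apex₁-vy apex₁-or-vy  δ≢ = ⊥-elim (δ≢ refl)
  realised-apex₁-vy apex₂-or-vx  _  =
    non-edge (λ { (inj₁ ()) ; (inj₂ ()) }) (inj₂ (<-num _ , num<num+ 12 (slot D) _))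
  realised-apex₁-vy (inner-at _) _  =
    non-edge (λ { (inj₁ ()) ; (inj₂ ()) }) (inj₂ (<-num _ , num<num+ 12 (slot D) _))

  realised-apex₂-inner : ∀ δ {s} → s ≤ D → Realised δ apex₂ (inner s)
  realised-apex₂-inner δ {s} s≤D = edge (inj₁ (apex₂-inner s≤D))
    (inj₂ (proj₁ (inner-below (before δ s) s≤D) , proj₂ (inner-above (before δ s) s (0<slot s))))

  realised-apex₂-vx : ∀ δ → δ ≢ apex₂-or-vx → Realised δ apex₂ vx
  realised-apex₂-vx apex₂-or-vx  δ≢ = ⊥-elim (δ≢ refl)
  realised-apex₂-vx apex₁-or-vy  _  =
    non-edge (λ { (inj₁ ()) ; (inj₂ ()) }) (inj₁ (+-num-< (slot D) 12 14 _ , num<num+ 9 (slot D) _))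
  realised-apex₂-vx (inner-at _) _  =
    non-edge (λ { (inj₁ ()) ; (inj₂ ()) }) (inj₁ (+-num-< (slot D) 12 14 _ , num<num+ 9 (slot D) _))

  realised-apex₂-vy : ∀ δ → Realised δ apex₂ vy
  realised-apex₂-vy δ = edge (inj₁ apex₂-vy)
    (inj₂ (≤-<-trans (vy-first-≤ δ) (num<num+ 12 (slot D) _) , <-num _))

  realised-vx-vy : ∀ δ → Realised δ vx vy
  realised-vx-vy δ = non-edge (λ { (inj₁ ()) ; (inj₂ ()) })
    (inj₂ (≤-<-trans (vy-first-≤ δ) (<-≤-trans (m<m+n 7 (0<slot D)) (vx-first-≥ δ)) ,
           num<num+ 9 (slot D) _))

  realised-inner-vx : ∀ δ {s} → InRange D δ → s ≤ D → Realised δ (inner s) vx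
  realised-inner-vx δ {s} δ-in s≤D with m≤n⇒m<n∨m≡n s≤D
  ... | inj₁ s<D = non-edge (λ { (inj₁ inner-vx) → <-irrefl refl s<D ; (inj₂ ()) })
        (inj₁ (≤-<-trans (hi₁ (window (before δ s) s)) (<-≤-trans far (vx-first-≥ δ)) ,
               ≤-<-trans (hi₂ (window (before δ s) s)) (<-trans far (+-num-< (slot D) 7 9 _))))
    where
    far : 10 + slot s < 7 + slot D
    far = ≤-<-trans (+-monoʳ-≤ 6 (slot-mono s<D)) (+-num-< (slot D) 6 7 _)
  ... | inj₂ refl = edge (inj₁ inner-vx) (last δ δ-in)
    where
    after-last : Crossing (innerKeys false D) (14 + slot D , 9 + slot D)
    after-last = subst (λ k → Crossing k (14 + slot D , 9 + slot D)) (sym (innerKeys-even false m))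
                       (inj₁ (+-num-< (slot D) 2 14 _ , +-num-< (slot D) 9 10 _))
    last : ∀ δ → InRange D δ → Crossing (keys δ (inner D)) (keys δ vx)
    last apex₁-or-vy  _   = after-last
    last apex₂-or-vx  _   = subst (λ k → Crossing k (7 + slot D , 9 + slot D)) (sym (innerKeys-even true m))
                                  (inj₂ (+-num-< (slot D) 7 8 _ , m<n+m (slot D) (s≤s z≤n)))
    last (inner-at c) c≤D = subst (λ b → Crossing (innerKeys b D) (14 + slot D , 9 + slot D))
                                  (sym (before-last c≤D)) after-last

  realised-inner-vy : ∀ δ {s} → Spared δ s → Realised δ (inner s) vy
  realised-inner-vy apex₁-or-vy  {zero} _   = edge (inj₁ inner-vy) (inj₁ (<-num _ , <-num _))
  realised-inner-vy apex₂-or-vx  {zero} _   = edge (inj₁ inner-vy) (inj₂ (<-num _ , <-num _))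
  realised-inner-vy (inner-at c) {zero} 0≢c = edge (inj₁ inner-vy)
    (subst (λ b → Crossing (innerKeys b 0) (1 , 5)) (sym (before-first 0≢c)) (inj₂ (<-num _ , <-num _)))
  realised-inner-vy δ {suc s} _ = non-edge (λ { (inj₁ ()) ; (inj₂ ()) })
    (inj₂ (≤-<-trans (vy-first-≤ δ) (proj₁ above) , ≤-<-trans (≤-num _) (proj₂ above)))
    where
    above : 7 < proj₁ (innerKeys (before δ (suc s)) (suc s)) × 7 < proj₂ (innerKeys (before δ (suc s)) (suc s))
    above = inner-above (before δ (suc s)) (suc s) (+-monoʳ-≤ 4 (slot-≥4 s))

  private
    ¬adjacent-inner : ∀ {s t} → suc s < t → ¬ Adjacent D (inner s) (inner t)
    ¬adjacent-inner s+1<t (inj₁ (inner-inner _)) = <-irrefl refl s+1<t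
    ¬adjacent-inner s+1<t (inj₂ (inner-inner _)) = <-asym s+1<t (n≤1+n _)

  realised-inner-inner : ∀ δ {s t} → Spared δ t → s < t → t ≤ D → Realised δ (inner s) (inner t)
  realised-inner-inner δ {s} {t} t-ok s<t t≤D with m≤n⇒m<n∨m≡n s<t
  ... | inj₂ refl =
    edge (inj₁ (inner-inner t≤D)) (crossing-step (before δ s) (before δ t) s (before-suc δ t-ok))
  ... | inj₁ s+1<t with m≤n⇒m<n∨m≡n s+1<t
  ...   | inj₂ refl = non-edge (¬adjacent-inner s+1<t) (aligned-gap (before δ s) (before δ t) s (before-gap δ))
  ...   | inj₁ s+2<t = non-edge (¬adjacent-inner s+1<t) (far-aligned (before δ s) (before δ t) s s+2<t)

  realised : ∀ {r u v} → Valid D r → Valid D u → Valid D v → u ≢ r → v ≢ r → u ≢ v →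
             Realised (deletion r) u v
  realised {u = apex₁}   {apex₁}   _ _ _ _ _ u≢v = ⊥-elim (u≢v refl)
  realised {u = apex₁}   {apex₂}   _ _ _ _ _ _ = realised-apex₁-apex₂ _
  realised {u = apex₁}   {vx}      _ _ _ _ _ _ = realised-apex₁-vx _
  realised {u = apex₁}   {vy}      _ _ _ u≢r v≢r _ = realised-apex₁-vy _ (apex₁-vy-kept u≢r v≢r)
  realised {u = apex₁}   {inner t} _ _ t≤D _ _ _ = realised-apex₁-inner _ t≤D
  realised {u = apex₂}   {apex₁}   _ _ _ _ _ _ = realised-sym (realised-apex₁-apex₂ _)
  realised {u = apex₂}   {apex₂}   _ _ _ _ _ u≢v = ⊥-elim (u≢v refl)
  realised {u = apex₂}   {vx}      _ _ _ u≢r v≢r _ = realised-apex₂-vx _ (apex₂-vx-kept u≢r v≢r)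
  realised {u = apex₂}   {vy}      _ _ _ _ _ _ = realised-apex₂-vy _
  realised {u = apex₂}   {inner t} _ _ t≤D _ _ _ = realised-apex₂-inner _ t≤D
  realised {u = vx}      {apex₁}   _ _ _ _ _ _ = realised-sym (realised-apex₁-vx _)
  realised {u = vx}      {apex₂}   _ _ _ u≢r v≢r _ =
    realised-sym (realised-apex₂-vx _ (apex₂-vx-kept v≢r u≢r))
  realised {u = vx}      {vx}      _ _ _ _ _ u≢v = ⊥-elim (u≢v refl)
  realised {u = vx}      {vy}      _ _ _ _ _ _ = realised-vx-vy _
  realised {u = vx}      {inner t} r-ok _ t≤D _ _ _ =
    realised-sym (realised-inner-vx _ (deletion-in-range r-ok) t≤D)
  realised {u = vy}      {apex₁}   _ _ _ u≢r v≢r _ =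
    realised-sym (realised-apex₁-vy _ (apex₁-vy-kept v≢r u≢r))
  realised {u = vy}      {apex₂}   _ _ _ _ _ _ = realised-sym (realised-apex₂-vy _)
  realised {u = vy}      {vx}      _ _ _ _ _ _ = realised-sym (realised-vx-vy _)
  realised {u = vy}      {vy}      _ _ _ _ _ u≢v = ⊥-elim (u≢v refl)
  realised {u = vy}      {inner t} _ _ _ _ v≢r _ = realised-sym (realised-inner-vy _ (spared v≢r))
  realised {u = inner s} {apex₁}   _ s≤D _ _ _ _ = realised-sym (realised-apex₁-inner _ s≤D)
  realised {u = inner s} {apex₂}   _ s≤D _ _ _ _ = realised-sym (realised-apex₂-inner _ s≤D)
  realised {u = inner s} {vx}      r-ok s≤D _ _ _ _ = realised-inner-vx _ (deletion-in-range r-ok) s≤D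
  realised {u = inner s} {vy}      _ _ _ u≢r _ _ = realised-inner-vy _ (spared u≢r)
  realised {u = inner s} {inner t} _ s≤D t≤D u≢r v≢r u≢v with <-cmp s t
  ... | tri< s<t _ _ = realised-inner-inner _ (spared v≢r) s<t t≤D
  ... | tri≈ _ s≡t _ = ⊥-elim (u≢v (cong inner s≡t))
  ... | tri> _ _ t<s = realised-sym (realised-inner-inner _ (spared u≢r) t<s s≤D)

  keys-bounded : ∀ δ v → Valid D v → proj₁ (keys δ v) < 15 + slot D × proj₂ (keys δ v) < 15 + slot D
  keys-bounded δ apex₁     _   = num<num+ 15 (slot D) _ , +-num-< (slot D) 12 15 _
  keys-bounded δ apex₂     _   = +-num-< (slot D) 12 15 _ , num<num+ 15 (slot D) _
  keys-bounded δ vx        _   = ≤-<-trans (vx-first-≤ δ) (+-num-< (slot D) 14 15 _) , +-num-< (slot D) 9 15 _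
  keys-bounded δ vy        _   = ≤-<-trans (vy-first-≤ δ) (num<num+ 15 (slot D) _) , num<num+ 15 (slot D) _
  keys-bounded δ (inner s) s≤D = ≤-<-trans (hi₁ (window (before δ s) s)) bound ,
                                 ≤-<-trans (hi₂ (window (before δ s) s)) bound
    where
    bound : 10 + slot s < 15 + slot D
    bound = ≤-<-trans (+-monoʳ-≤ 10 (slot-mono s≤D)) (+-num-< (slot D) 10 15 _)

module Deletions (h : ℕ) where

  open Decoding h
  open Keys (suc h) hiding (D)

  vertex-deleted-representable : ∀ S → (∃[ r ] S r ≡ false) → WordRepresentable (Induced (G4 n) S)
  vertex-deleted-representable S (r , Sr≡false) = word , represents
    where
    GS : Graph
    GS = Induced (G4 n) S
    open TwoPermutations (_≟V_ GS) (present S (allFin _)) (present-unique S (allFin⁺ _))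
                         (λ (u , p) → ∈-present S p (∈-allFin u))
    κ : V GS → ℕ × ℕ
    κ a = keys (deletion (vertex r)) (vertex (proj₁ a))
    open Word κ (15 + slot D) (λ a → keys-bounded _ (vertex (proj₁ a)) (valid-vertexAt (toℕ (proj₁ a))))
    kept : ∀ (a : V GS) → vertex (proj₁ a) ≢ vertex r
    kept (u , p) eq with vertex-injective u r eq
    ... | refl = subst T Sr≡false p
    separate : ∀ {a b : V GS} → a ≢ b → vertex (proj₁ a) ≢ vertex (proj₁ b)
    separate {u , p} {v , q} a≢b eq with vertex-injective u v eq
    ... | refl = a≢b (cong (u ,_) (T-irrelevant p q))
    represents : ∀ a b → a ≢ b → E (G4 n) (proj₁ a) (proj₁ b) ⇔ Alternate (_≟V_ GS) a b word
    represents a b a≢b = realised⇒represented (realised {vertex r} {vertex (proj₁ a)} {vertex (proj₁ b)}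
      (valid-vertexAt (toℕ r)) (valid-vertexAt (toℕ (proj₁ a))) (valid-vertexAt (toℕ (proj₁ b)))
      (kept a) (kept b) (separate a≢b))
      where
      realised⇒represented : Realised (deletion (vertex r)) (vertex (proj₁ a)) (vertex (proj₁ b)) →
                             E (G4 n) (proj₁ a) (proj₁ b) ⇔ Alternate (_≟V_ GS) a b word
      realised⇒represented (edge adj crossing) =
        mk⇔ (λ _ → crossing⇒alternate {a} {b} crossing)
            (λ _ → Equivalence.from (edge⇔adjacent (proj₁ a) (proj₁ b)) adj)
      realised⇒represented (non-edge ¬adj aligned) =
        mk⇔ (⊥-elim ∘ ¬adj ∘ Equivalence.to (edge⇔adjacent (proj₁ a) (proj₁ b)))
            (⊥-elim ∘ aligned⇒¬alternate {a} {b} aligned)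

theorem11 : (n : ℕ) → 3 ≤ n → MinimalNonWordRepresentable (G4 n)
theorem11 _ (s≤s (s≤s (s≤s {n = k} _))) =
  NonRepresentability.not-word-representable k , Deletions.vertex-deleted-representable (suc k)
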